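{- Let $A\in\mathbb{F}_2[x]$ be a nonconstant polynomial which is special and perfect. Then $$\sum_{\substack{D\mid A,\ D\neq A,\ D\neq 1\\ A/D\text{ square-free}}}\sigma^{*\mathrm{inv}}(D)=\sigma(\mathrm{rad}(A)).$$
   Context: $\sigma(A)$ is the sum of all divisors of $A$ in $\mathbb{F}_2[x]$; $A$ is perfect if $\sigma(A)=A$. $A$ is special if $A=S^2$ for some square-free $S\in\mathbb{F}_2[x]$ (a notion used for odd perfect polynomials, i.e. perfect polynomials with no irreducible factor of degree $1$). $\mathrm{rad}(A)$ is the product of the distinct irreducible factors of $A$. A divisor $D$ of $A$ is unitary if $\gcd(D,A/D)=1$, and $\sigma^*(A)$ is the sum of all unitary divisors of $A$. A function $f:\mathbb{F}_2[x]\setminus\{0\}\to\mathbb{F}_2[x]$ is multiplicative if $f(AB)=f(A)f(B)$ whenever $\gcd(A,B)=1$; the Dirichlet convolution is $(f*g)(A)=\sum_{D\mid A}f(D)g(A/D)$; $\delta(1)=1$, $\delta(A)=0$ for $A\ne1$; $\sigma^{*\mathrm{inv}}$ is the unique multiplicative function with $\sigma^**\sigma^{*\mathrm{inv}}=\delta$. Sums over $D\mid A$ run over all divisors of $A$ in $\mathbb{F}_2[x]$. -}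

module Defs where

open import Data.Bool using (Bool; true; false; not; _∧_; _∨_; _xor_; if_then_else_)
open import Data.Nat using (ℕ; zero; suc)
open import Data.List using (List; []; _∷_; map; _++_; foldr; filterᵇ; cartesianProduct)
open import Data.Bool.ListAction using (any; all)
open import Data.Product using (_×_; _,_; proj₁; proj₂; ∃)
open import Data.Sum using (_⊎_)
open import Relation.Nullary using (¬_; Dec; yes; no)
open import Relation.Nullary.Decidable using (⌊_⌋)
open import Relation.Binary.PropositionalEquality using (_≡_; _≢_; refl; cong; cong₂)
open import Relation.Binary.Definitions using (DecidableEquality)

-- Polynomials over F₂ with a canonical (unique) representation.
-- A nonzero polynomial is either 1, or  c + x·P  with P nonzero.
-- Hence propositional equality _≡_ is equality of polynomials.

data Poly⁺ : Set where
  one  : Poly⁺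
  _,x_ : Bool → Poly⁺ → Poly⁺

data Poly : Set where
  𝟘  : Poly
  nz : Poly⁺ → Poly

𝟙 : Poly
𝟙 = nz one

cons : Bool → Poly → Poly
cons false 𝟘      = 𝟘
cons true  𝟘      = 𝟙
cons b     (nz p) = nz (b ,x p)

add⁺ : Poly⁺ → Poly⁺ → Poly
add⁺ one      one      = 𝟘
add⁺ one      (b ,x q) = nz (not b ,x q)
add⁺ (b ,x p) one      = nz (not b ,x p)
add⁺ (b ,x p) (c ,x q) = cons (b xor c) (add⁺ p q)

infixl 6 _+_
_+_ : Poly → Poly → Poly
𝟘    + q    = q
nz p + 𝟘    = nz p
nz p + nz q = add⁺ p q

mul⁺ : Poly⁺ → Poly⁺ → Poly
mul⁺ one      q = nz q
mul⁺ (b ,x p) q = (if b then nz q else 𝟘) + cons false (mul⁺ p q)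

infixl 7 _*_
_*_ : Poly → Poly → Poly
𝟘    * q    = 𝟘
nz p * 𝟘    = 𝟘
nz p * nz q = mul⁺ p q

-- degree (deg 𝟘 is set to 0 by convention; never relevant below)
deg⁺ : Poly⁺ → ℕ
deg⁺ one      = zero
deg⁺ (_ ,x p) = suc (deg⁺ p)

deg : Poly → ℕ
deg 𝟘      = zero
deg (nz p) = deg⁺ p

NonConstant : Poly → Set
NonConstant A = 1≤ (deg A)
  where
  1≤ : ℕ → Set
  1≤ zero    = Data.Empty.⊥
    where import Data.Empty
  1≤ (suc _) = Data.Unit.⊤
    where import Data.Unit

_≟⁺_ : DecidableEquality Poly⁺
one      ≟⁺ one      = yes refl
one      ≟⁺ (_ ,x _) = no λ ()
(_ ,x _) ≟⁺ one      = no λ ()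
(b ,x p) ≟⁺ (c ,x q) with Data.Bool._≟_ b c | p ≟⁺ q
  where import Data.Bool
... | yes refl | yes refl = yes refl
... | no b≢c   | _        = no λ { refl → b≢c refl }
... | yes _    | no p≢q   = no λ { refl → p≢q refl }

_≟_ : DecidableEquality Poly
𝟘    ≟ 𝟘    = yes refl
𝟘    ≟ nz _ = no λ ()
nz _ ≟ 𝟘    = no λ ()
nz p ≟ nz q with p ≟⁺ q
... | yes refl = yes refl
... | no p≢q   = no λ { refl → p≢q refl }

_==_ : Poly → Poly → Bool
A == B = ⌊ A ≟ B ⌋

infix 4 _∣_
_∣_ : Poly → Poly → Set
B ∣ A = ∃ λ C → B * C ≡ A

-- gcd(A,B) = 1 : the only common divisors are the units (in F₂[x]: only 1)
Coprime : Poly → Poly → Set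
Coprime A B = ∀ E → E ∣ A → E ∣ B → E ≡ 𝟙

Irreducible : Poly → Set
Irreducible P = NonConstant P × (∀ B C → B * C ≡ P → B ≡ 𝟙 ⊎ C ≡ 𝟙)

SquareFree : Poly → Set
SquareFree S = S ≢ 𝟘 × (∀ P → Irreducible P → ¬ (P * P ∣ S))

Special : Poly → Set
Special A = ∃ λ S → SquareFree S × A ≡ S * S

polysOfDeg : ℕ → List Poly⁺
polysOfDeg zero    = one ∷ []
polysOfDeg (suc n) = map (false ,x_) (polysOfDeg n) ++ map (true ,x_) (polysOfDeg n)

polysUpTo : ℕ → List Poly
polysUpTo zero    = map nz (polysOfDeg zero)
polysUpTo (suc n) = polysUpTo n ++ map nz (polysOfDeg (suc n))

-- For A ≠ 0 both factors
-- have degree ≤ deg A, so this is the complete list of factorisations;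
-- every divisor D of A occurs exactly once, paired with C = A/D.
-- (divPairs 𝟘 = [] by convention.)
divPairs : Poly → List (Poly × Poly)
divPairs A = filterᵇ (λ DC → (proj₁ DC * proj₂ DC) == A)
                     (cartesianProduct (polysUpTo (deg A)) (polysUpTo (deg A)))

divisors : Poly → List Poly
divisors A = map proj₁ (divPairs A)

-- Boolean divisibility test (correct for A ≠ 0)
divides? : Poly → Poly → Bool
divides? B A = any (λ C → (B * C) == A) (polysUpTo (deg A))

irreducible? : Poly → Bool
irreducible? P = ncst (deg P) ∧ all (λ D → (D == 𝟙) ∨ (D == P)) (divisors P)
  where
  ncst : ℕ → Bool
  ncst zero    = false
  ncst (suc _) = true

-- Boolean square-freeness test (correct for S ≠ 0):
-- no square of an irreducible polynomial divides S
squareFree? : Poly → Bool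
squareFree? S = all (λ P → not (irreducible? P ∧ divides? (P * P) S)) (polysUpTo (deg S))

coprime? : Poly → Poly → Bool
coprime? A B = all (λ E → not (divides? E A ∧ divides? E B) ∨ (E == 𝟙)) (polysUpTo (deg A))

sumP : List Poly → Poly
sumP = foldr _+_ 𝟘

prodP : List Poly → Poly
prodP = foldr _*_ 𝟙

σ : Poly → Poly
σ A = sumP (divisors A)

Perfect : Poly → Set
Perfect A = σ A ≡ A

σ* : Poly → Poly
σ* A = sumP (map proj₁ (filterᵇ (λ DC → coprime? (proj₁ DC) (proj₂ DC)) (divPairs A)))

rad : Poly → Poly
rad A = prodP (filterᵇ irreducible? (divisors A))

_⋆_ : (Poly → Poly) → (Poly → Poly) → Poly → Poly
(f ⋆ g) A = sumP (map (λ DC → f (proj₁ DC) * g (proj₂ DC)) (divPairs A))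

δ : Poly → Poly
δ A = if A == 𝟙 then 𝟙 else 𝟘

Multiplicative : (Poly → Poly) → Set
Multiplicative f = ∀ A B → A ≢ 𝟘 → B ≢ 𝟘 → Coprime A B → f (A * B) ≡ f A * f B

IsSigmaStarInv : (Poly → Poly) → Set
IsSigmaStarInv g = Multiplicative g × (∀ A → A ≢ 𝟘 → (σ* ⋆ g) A ≡ δ A)

restrictedSum : (Poly → Poly) → Poly → Poly
restrictedSum g A =
  sumP (map (λ DC → g (proj₁ DC))
            (filterᵇ (λ DC → not (proj₁ DC == A) ∧ not (proj₁ DC == 𝟙) ∧ squareFree? (proj₂ DC))
                     (divPairs A)))

-- Write A = S² with S square-free and let g = σ*⁻¹. Evaluating σ* ⋆ g = δ at an irreducible P and at P²
-- gives g(P) = 1 + P and g(P²) = 0, because σ*(P²) = 1 + P² = (1 + P)² in characteristic 2. By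
-- multiplicativity g agrees with σ on square-free polynomials and vanishes on every divisor of S² with a
-- square factor (such a divisor is P²·D′ with P ∤ D′). In the restricted sum the cofactor A/D is
-- square-free; if D is square-free as well, D · (A/D) = S² forces D = S. So the sum is g(S) = σ(S),
-- and σ(S) = σ(rad A) since rad(S²) = S.

module Submission where

open import Defs
open import Relation.Binary.PropositionalEquality using (_≡_)

open import Algebra.Bundles using (CommutativeRing)
open import Algebra.Structures using (IsCommutativeRing)
import Algebra.Properties.Group as GroupProperties
open import Data.Bool using (Bool; true; false; not; _xor_; _∧_; _∨_; T)
open import Data.Bool.Properties using (xor-comm; xor-assoc; xor-same; xor-identityʳ; ∧-comm; T?; T-∧; T-∨)
open import Data.Empty using (⊥; ⊥-elim)
open import Data.Maybe using (nothing)
import Data.Nat as ℕ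
open import Data.Nat using (ℕ; zero; suc; z≤n; s≤s; s≤s⁻¹)
import Data.Nat.Properties as ℕ
open import Data.Product using (_×_; _,_; proj₁; proj₂; ∃; ∃₂; Σ)
open import Data.Sum using (_⊎_; inj₁; inj₂)
open import Data.List using (List; []; _∷_; map; _++_; filterᵇ; cartesianProduct)
open import Data.List.Membership.Propositional using (_∈_; find; lose)
open import Data.List.Membership.Propositional.Properties
  using (∈-map⁺; ∈-map⁻; ∈-++⁺ˡ; ∈-++⁺ʳ; ∈-++⁻; ∈-filter⁺; ∈-filter⁻; ∈-cartesianProduct⁺)
open import Data.List.Relation.Binary.BagAndSetEquality using (∼bag⇒↭)
open import Data.List.Relation.Binary.Permutation.Propositional using (_↭_; ↭⇒↭ₛ)
import Data.List.Relation.Binary.Permutation.Propositional.Properties as ↭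
import Data.List.Relation.Binary.Permutation.Setoid.Properties as ↭ₛ
open import Data.List.Membership.Propositional.Properties.WithK using (unique∧set⇒bag)
open import Data.List.Relation.Unary.All as All using (All)
open import Data.List.Relation.Unary.All.Properties using (all⁺; all⁻; ¬All⇒Any¬)
open import Data.List.Relation.Unary.Any using (here; there)
open import Data.List.Relation.Unary.Any.Properties using (any⁺; any⁻)
open import Data.List.Relation.Unary.Unique.Propositional using (Unique; []; _∷_)
import Data.List.Relation.Unary.Unique.Propositional.Properties as Unique
open import Data.Unit using (tt)
open import Function.Bundles using (Equivalence; mk⇔)
open import Relation.Nullary.Decidable using (toWitness; fromWitness; fromWitnessFalse)
open import Relation.Nullary using (¬_; Dec; yes; no)
open import Function using (id; _∘_)
open import Relation.Binary.PropositionalEquality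
  using (_≢_; refl; sym; trans; cong; cong₂; subst; isEquivalence; setoid; module ≡-Reasoning)
open import Tactic.RingSolver using (solve-∀)
open import Tactic.RingSolver.Core.AlmostCommutativeRing
  using (AlmostCommutativeRing; fromCommutativeRing)

open ≡-Reasoning

-- The ring F₂[x]

head : Poly → Bool
head 𝟘             = false
head (nz one)      = true
head (nz (b ,x _)) = b

tail : Poly → Poly
tail 𝟘             = 𝟘
tail (nz one)      = 𝟘
tail (nz (_ ,x p)) = nz p

cons-head-tail : ∀ A → cons (head A) (tail A) ≡ A
cons-head-tail 𝟘                 = refl
cons-head-tail (nz one)          = refl
cons-head-tail (nz (false ,x _)) = refl
cons-head-tail (nz (true ,x _))  = refl

head-cons : ∀ b X → head (cons b X) ≡ b
head-cons false 𝟘      = refl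
head-cons true  𝟘      = refl
head-cons false (nz _) = refl
head-cons true  (nz _) = refl

tail-cons : ∀ b X → tail (cons b X) ≡ X
tail-cons false 𝟘      = refl
tail-cons true  𝟘      = refl
tail-cons false (nz _) = refl
tail-cons true  (nz _) = refl

≡-by-head-tail : ∀ {A B} → head A ≡ head B → tail A ≡ tail B → A ≡ B
≡-by-head-tail {A} {B} h t =
  trans (sym (cons-head-tail A)) (trans (cong₂ cons h t) (cons-head-tail B))

tail-induction : (P : Poly → Set) → P 𝟘 → (∀ A → P (tail A) → P A) → ∀ A → P A
tail-induction P P𝟘 step 𝟘      = P𝟘
tail-induction P P𝟘 step (nz p) = go p
  where
  go : ∀ p → P (nz p)
  go one      = step 𝟙 P𝟘
  go (b ,x p) = step (nz (b ,x p)) (go p)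

+-identityˡ : ∀ A → 𝟘 + A ≡ A
+-identityˡ _ = refl

+-identityʳ : ∀ A → A + 𝟘 ≡ A
+-identityʳ 𝟘      = refl
+-identityʳ (nz _) = refl

cons-+-cons : ∀ a b X Y → cons a X + cons b Y ≡ cons (a xor b) (X + Y)
cons-+-cons false false 𝟘      𝟘      = refl
cons-+-cons false true  𝟘      𝟘      = refl
cons-+-cons true  false 𝟘      𝟘      = refl
cons-+-cons true  true  𝟘      𝟘      = refl
cons-+-cons false _     𝟘      (nz _) = refl
cons-+-cons true  false 𝟘      (nz _) = refl
cons-+-cons true  true  𝟘      (nz _) = refl
cons-+-cons false false (nz _) 𝟘      = refl
cons-+-cons false true  (nz _) 𝟘      = refl
cons-+-cons true  false (nz _) 𝟘      = refl
cons-+-cons true  true  (nz _) 𝟘      = refl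
cons-+-cons false false (nz _) (nz _) = refl
cons-+-cons false true  (nz _) (nz _) = refl
cons-+-cons true  false (nz _) (nz _) = refl
cons-+-cons true  true  (nz _) (nz _) = refl

+-via-head-tail : ∀ A B → A + B ≡ cons (head A xor head B) (tail A + tail B)
+-via-head-tail A B = begin
  A + B                                             ≡⟨ sym (cong₂ _+_ (cons-head-tail A) (cons-head-tail B)) ⟩
  cons (head A) (tail A) + cons (head B) (tail B)   ≡⟨ cons-+-cons (head A) (head B) (tail A) (tail B) ⟩
  cons (head A xor head B) (tail A + tail B)        ∎

head-+ : ∀ A B → head (A + B) ≡ head A xor head B
head-+ A B = trans (cong head (+-via-head-tail A B)) (head-cons _ _)

tail-+ : ∀ A B → tail (A + B) ≡ tail A + tail B
tail-+ A B = trans (cong tail (+-via-head-tail A B)) (tail-cons _ _)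

+-comm : ∀ A B → A + B ≡ B + A
+-comm = tail-induction (λ A → ∀ B → A + B ≡ B + A) (λ B → sym (+-identityʳ B)) λ A ih B →
  ≡-by-head-tail
    (begin
      head (A + B)          ≡⟨ head-+ A B ⟩
      head A xor head B     ≡⟨ xor-comm (head A) (head B) ⟩
      head B xor head A     ≡⟨ head-+ B A ⟨
      head (B + A)          ∎)
    (begin
      tail (A + B)          ≡⟨ tail-+ A B ⟩
      tail A + tail B       ≡⟨ ih (tail B) ⟩
      tail B + tail A       ≡⟨ tail-+ B A ⟨
      tail (B + A)          ∎)

+-assoc : ∀ A B C → (A + B) + C ≡ A + (B + C)
+-assoc = tail-induction (λ A → ∀ B C → (A + B) + C ≡ A + (B + C)) (λ _ _ → refl) λ A ih B C →
  ≡-by-head-tail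
    (begin
      head ((A + B) + C)                   ≡⟨ trans (head-+ (A + B) C) (cong (_xor head C) (head-+ A B)) ⟩
      (head A xor head B) xor head C       ≡⟨ xor-assoc (head A) (head B) (head C) ⟩
      head A xor (head B xor head C)       ≡⟨ trans (head-+ A (B + C)) (cong (head A xor_) (head-+ B C)) ⟨
      head (A + (B + C))                   ∎)
    (begin
      tail ((A + B) + C)                   ≡⟨ trans (tail-+ (A + B) C) (cong (_+ tail C) (tail-+ A B)) ⟩
      (tail A + tail B) + tail C           ≡⟨ ih (tail B) (tail C) ⟩
      tail A + (tail B + tail C)           ≡⟨ trans (tail-+ A (B + C)) (cong (tail A +_) (tail-+ B C)) ⟨
      tail (A + (B + C))                   ∎)

+-self : ∀ A → A + A ≡ 𝟘
+-self = tail-induction (λ A → A + A ≡ 𝟘) refl λ A ih →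
  ≡-by-head-tail (trans (head-+ A A) (xor-same (head A))) (trans (tail-+ A A) ih)

scale : Bool → Poly → Poly
scale false _ = 𝟘
scale true  B = B

head-scale : ∀ b B → head (scale b B) ≡ b ∧ head B
head-scale false _ = refl
head-scale true  _ = refl

tail-scale : ∀ b B → tail (scale b B) ≡ scale b (tail B)
tail-scale false _ = refl
tail-scale true  _ = refl

scale-xor : ∀ a b X → scale (a xor b) X ≡ scale a X + scale b X
scale-xor false _     _ = refl
scale-xor true  false X = sym (+-identityʳ X)
scale-xor true  true  X = sym (+-self X)

scale-* : ∀ b X C → scale b X * C ≡ scale b (X * C)
scale-* false _ _ = refl
scale-* true  _ _ = refl

scale-𝟘 : ∀ b → scale b 𝟘 ≡ 𝟘
scale-𝟘 false = refl
scale-𝟘 true  = refl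

*-zeroʳ : ∀ A → A * 𝟘 ≡ 𝟘
*-zeroʳ 𝟘      = refl
*-zeroʳ (nz _) = refl

*-identityˡ : ∀ A → 𝟙 * A ≡ A
*-identityˡ 𝟘      = refl
*-identityˡ (nz _) = refl

*-unfoldˡ : ∀ A B → A * B ≡ scale (head A) B + cons false (tail A * B)
*-unfoldˡ 𝟘                 _      = refl
*-unfoldˡ (nz one)          𝟘      = refl
*-unfoldˡ (nz one)          (nz _) = refl
*-unfoldˡ (nz (false ,x _)) 𝟘      = refl
*-unfoldˡ (nz (true ,x _))  𝟘      = refl
*-unfoldˡ (nz (false ,x _)) (nz _) = refl
*-unfoldˡ (nz (true ,x _))  (nz _) = refl

head-scale-+-shift : ∀ b X Y → head (scale b X + cons false Y) ≡ b ∧ head X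
head-scale-+-shift b X Y = begin
  head (scale b X + cons false Y)           ≡⟨ head-+ (scale b X) (cons false Y) ⟩
  head (scale b X) xor head (cons false Y)  ≡⟨ cong₂ _xor_ (head-scale b X) (head-cons false Y) ⟩
  (b ∧ head X) xor false                    ≡⟨ xor-identityʳ _ ⟩
  b ∧ head X                                ∎

tail-scale-+-shift : ∀ b X Y → tail (scale b X + cons false Y) ≡ scale b (tail X) + Y
tail-scale-+-shift b X Y =
  trans (tail-+ (scale b X) (cons false Y)) (cong₂ _+_ (tail-scale b X) (tail-cons false Y))

head-* : ∀ A B → head (A * B) ≡ head A ∧ head B
head-* A B = trans (cong head (*-unfoldˡ A B)) (head-scale-+-shift (head A) B (tail A * B))

tail-* : ∀ A B → tail (A * B) ≡ scale (head A) (tail B) + tail A * B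
tail-* A B = trans (cong tail (*-unfoldˡ A B)) (tail-scale-+-shift (head A) B (tail A * B))

+-interchange : ∀ A B C D → (A + B) + (C + D) ≡ (A + C) + (B + D)
+-interchange A B C D = begin
  (A + B) + (C + D)   ≡⟨ +-assoc A B (C + D) ⟩
  A + (B + (C + D))   ≡⟨ cong (A +_) (+-assoc B C D) ⟨
  A + ((B + C) + D)   ≡⟨ cong (λ Z → A + (Z + D)) (+-comm B C) ⟩
  A + ((C + B) + D)   ≡⟨ cong (A +_) (+-assoc C B D) ⟩
  A + (C + (B + D))   ≡⟨ +-assoc A C (B + D) ⟨
  (A + C) + (B + D)   ∎

*-distribʳ-+ : ∀ A B C → (A + B) * C ≡ A * C + B * C
*-distribʳ-+ = tail-induction (λ A → ∀ B C → (A + B) * C ≡ A * C + B * C) (λ _ _ → refl) λ A ih B C →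
  let a = head A; b = head B in begin
  (A + B) * C
    ≡⟨ *-unfoldˡ (A + B) C ⟩
  scale (head (A + B)) C + cons false (tail (A + B) * C)
    ≡⟨ cong₂ (λ u V → scale u C + cons false (V * C)) (head-+ A B) (tail-+ A B) ⟩
  scale (a xor b) C + cons false ((tail A + tail B) * C)
    ≡⟨ cong₂ (λ U V → U + cons false V) (scale-xor a b C) (ih (tail B) C) ⟩
  (scale a C + scale b C) + cons false (tail A * C + tail B * C)
    ≡⟨ cong (scale a C + scale b C +_) (cons-+-cons false false (tail A * C) (tail B * C)) ⟨
  (scale a C + scale b C) + (cons false (tail A * C) + cons false (tail B * C))
    ≡⟨ +-interchange (scale a C) (scale b C) (cons false (tail A * C)) (cons false (tail B * C)) ⟩
  (scale a C + cons false (tail A * C)) + (scale b C + cons false (tail B * C))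
    ≡⟨ cong₂ _+_ (*-unfoldˡ A C) (*-unfoldˡ B C) ⟨
  A * C + B * C
    ∎

*-unfoldʳ : ∀ A B → A * B ≡ scale (head B) A + cons false (A * tail B)
*-unfoldʳ = tail-induction (λ A → ∀ B → A * B ≡ scale (head B) A + cons false (A * tail B))
  (λ B → sym (cong (_+ 𝟘) (scale-𝟘 (head B)))) λ A ih B →
  ≡-by-head-tail
    (begin
      head (A * B)                                  ≡⟨ head-* A B ⟩
      head A ∧ head B                               ≡⟨ ∧-comm (head A) (head B) ⟩
      head B ∧ head A                               ≡⟨ head-scale-+-shift (head B) A (A * tail B) ⟨
      head (scale (head B) A + cons false (A * tail B)) ∎)
    (begin
      tail (A * B)
        ≡⟨ tail-* A B ⟩
      scale (head A) (tail B) + tail A * B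
        ≡⟨ cong (scale (head A) (tail B) +_) (ih B) ⟩
      scale (head A) (tail B) + (scale (head B) (tail A) + cons false (tail A * tail B))
        ≡⟨ +-assoc (scale (head A) (tail B)) (scale (head B) (tail A)) _ ⟨
      (scale (head A) (tail B) + scale (head B) (tail A)) + cons false (tail A * tail B)
        ≡⟨ cong (_+ cons false (tail A * tail B)) (+-comm (scale (head A) (tail B)) (scale (head B) (tail A))) ⟩
      (scale (head B) (tail A) + scale (head A) (tail B)) + cons false (tail A * tail B)
        ≡⟨ +-assoc (scale (head B) (tail A)) (scale (head A) (tail B)) _ ⟩
      scale (head B) (tail A) + (scale (head A) (tail B) + cons false (tail A * tail B))
        ≡⟨ cong (scale (head B) (tail A) +_) (*-unfoldˡ A (tail B)) ⟨
      scale (head B) (tail A) + A * tail B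
        ≡⟨ tail-scale-+-shift (head B) A (A * tail B) ⟨
      tail (scale (head B) A + cons false (A * tail B))
        ∎)

*-comm : ∀ A B → A * B ≡ B * A
*-comm = tail-induction (λ A → ∀ B → A * B ≡ B * A) (λ B → sym (*-zeroʳ B)) λ A ih B → begin
  A * B                                          ≡⟨ *-unfoldˡ A B ⟩
  scale (head A) B + cons false (tail A * B)     ≡⟨ cong (λ Z → scale (head A) B + cons false Z) (ih B) ⟩
  scale (head A) B + cons false (B * tail A)     ≡⟨ *-unfoldʳ B A ⟨
  B * A                                          ∎

*-distribˡ-+ : ∀ A B C → A * (B + C) ≡ A * B + A * C
*-distribˡ-+ A B C = begin
  A * (B + C)     ≡⟨ *-comm A (B + C) ⟩
  (B + C) * A     ≡⟨ *-distribʳ-+ B C A ⟩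
  B * A + C * A   ≡⟨ cong₂ _+_ (*-comm B A) (*-comm C A) ⟩
  A * B + A * C   ∎

shift-* : ∀ X C → cons false X * C ≡ cons false (X * C)
shift-* X C = trans (*-unfoldˡ (cons false X) C)
  (cong₂ (λ u V → scale u C + cons false (V * C)) (head-cons false X) (tail-cons false X))

*-assoc : ∀ A B C → (A * B) * C ≡ A * (B * C)
*-assoc = tail-induction (λ A → ∀ B C → (A * B) * C ≡ A * (B * C)) (λ _ _ → refl) λ A ih B C → begin
  (A * B) * C                                            ≡⟨ cong (_* C) (*-unfoldˡ A B) ⟩
  (scale (head A) B + cons false (tail A * B)) * C       ≡⟨ *-distribʳ-+ (scale (head A) B) (cons false (tail A * B)) C ⟩
  scale (head A) B * C + cons false (tail A * B) * C     ≡⟨ cong₂ _+_ (scale-* (head A) B C) (shift-* (tail A * B) C) ⟩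
  scale (head A) (B * C) + cons false ((tail A * B) * C) ≡⟨ cong (λ Z → scale (head A) (B * C) + cons false Z) (ih B C) ⟩
  scale (head A) (B * C) + cons false (tail A * (B * C)) ≡⟨ *-unfoldˡ A (B * C) ⟨
  A * (B * C)                                            ∎

*-identityʳ : ∀ A → A * 𝟙 ≡ A
*-identityʳ A = trans (*-comm A 𝟙) (*-identityˡ A)

-- Negation is the identity: in characteristic 2 every polynomial is its own additive inverse.
+-*-isCommutativeRing : IsCommutativeRing _≡_ _+_ _*_ id 𝟘 𝟙
+-*-isCommutativeRing = record
  { isRing = record
    { +-isAbelianGroup = record
      { isGroup = record
        { isMonoid = record
          { isSemigroup = record
            { isMagma = record { isEquivalence = isEquivalence ; ∙-cong = cong₂ _+_ }
            ; assoc   = +-assoc }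
          ; identity = +-identityˡ , +-identityʳ }
        ; inverse = +-self , +-self
        ; ⁻¹-cong = cong id }
      ; comm = +-comm }
    ; *-cong     = cong₂ _*_
    ; *-assoc    = *-assoc
    ; *-identity = *-identityˡ , *-identityʳ
    ; distrib    = *-distribˡ-+ , λ A B C → *-distribʳ-+ B C A }
  ; *-comm = *-comm }

+-*-commutativeRing : CommutativeRing _ _
+-*-commutativeRing = record { isCommutativeRing = +-*-isCommutativeRing }

ring : AlmostCommutativeRing _ _
ring = fromCommutativeRing +-*-commutativeRing (λ _ → nothing)

open GroupProperties (CommutativeRing.+-group +-*-commutativeRing)
  using () renaming (x∙y⁻¹≈ε⇒x≈y to +≡𝟘⇒≡)

x≡y+z⇒z≡y+x : ∀ {X Y Z} → X ≡ Y + Z → Z ≡ Y + X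
x≡y+z⇒z≡y+x {X} {Y} {Z} X≡Y+Z = sym (begin
  Y + X          ≡⟨ cong (Y +_) X≡Y+Z ⟩
  Y + (Y + Z)    ≡⟨ +-assoc Y Y Z ⟨
  (Y + Y) + Z    ≡⟨ cong (_+ Z) (+-self Y) ⟩
  Z              ∎)

frobenius : ∀ A B → (A + B) * (A + B) ≡ A * A + B * B
frobenius A B = begin
  (A + B) * (A + B)                  ≡⟨ expand A B ⟩
  A * A + B * B + (A * B + A * B)    ≡⟨ cong (A * A + B * B +_) (+-self (A * B)) ⟩
  A * A + B * B + 𝟘                  ≡⟨ +-identityʳ (A * A + B * B) ⟩
  A * A + B * B                      ∎
  where
  expand : ∀ A B → (A + B) * (A + B) ≡ A * A + B * B + (A * B + A * B)
  expand = solve-∀ ring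

cons-nz : ∀ b r → Σ Poly⁺ λ r′ → cons b (nz r) ≡ nz r′ × deg⁺ r′ ≡ suc (deg⁺ r)
cons-nz false r = (false ,x r) , refl , refl
cons-nz true  r = (true ,x r) , refl , refl

+-lower-degree : ∀ s r → deg⁺ s ℕ.< deg⁺ r → Σ Poly⁺ λ r′ → nz s + nz r ≡ nz r′ × deg⁺ r′ ≡ deg⁺ r
+-lower-degree one      (b ,x r) _         = (not b ,x r) , refl , refl
+-lower-degree (c ,x s) (b ,x r) (s≤s s<r) with +-lower-degree s r s<r
... | r′ , s+r≡r′ , deg≡ with cons-nz (c xor b) r′
... | r″ , cons≡r″ , deg≡′ = r″ , trans (cong (cons (c xor b)) s+r≡r′) cons≡r″ , trans deg≡′ (cong suc deg≡)

mul⁺-degree : ∀ p q → Σ Poly⁺ λ r → mul⁺ p q ≡ nz r × deg⁺ r ≡ deg⁺ p ℕ.+ deg⁺ q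
mul⁺-degree one          q = q , refl , refl
mul⁺-degree (false ,x p) q with mul⁺-degree p q
... | r , pq≡r , deg≡ = (false ,x r) , cong (cons false) pq≡r , cong suc deg≡
mul⁺-degree (true ,x p)  q with mul⁺-degree p q
... | r , pq≡r , deg≡ with +-lower-degree q (false ,x r) (s≤s (ℕ.≤-trans (ℕ.m≤n+m (deg⁺ q) (deg⁺ p)) (ℕ.≤-reflexive (sym deg≡))))
... | r′ , q+xr≡r′ , deg≡′ = r′ , trans (cong (λ Z → nz q + cons false Z) pq≡r) q+xr≡r′ , trans deg≡′ (cong suc deg≡)

*-≢𝟘 : ∀ {A B} → A ≢ 𝟘 → B ≢ 𝟘 → A * B ≢ 𝟘
*-≢𝟘 {𝟘}             A≢𝟘 _   = ⊥-elim (A≢𝟘 refl)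
*-≢𝟘 {nz _} {𝟘}      _   B≢𝟘 = ⊥-elim (B≢𝟘 refl)
*-≢𝟘 {nz p} {nz q}   _   _   pq≡𝟘 with mul⁺-degree p q
... | r , pq≡r , _ with trans (sym pq≡𝟘) pq≡r
... | ()

deg-* : ∀ {A B} → A ≢ 𝟘 → B ≢ 𝟘 → deg (A * B) ≡ deg A ℕ.+ deg B
deg-* {𝟘}           A≢𝟘 _   = ⊥-elim (A≢𝟘 refl)
deg-* {nz _} {𝟘}    _   B≢𝟘 = ⊥-elim (B≢𝟘 refl)
deg-* {nz p} {nz q} _   _   with mul⁺-degree p q
... | r , pq≡r , deg≡ = trans (cong deg pq≡r) deg≡

factorˡ-≢𝟘 : ∀ {A B C} → C ≢ 𝟘 → A * B ≡ C → A ≢ 𝟘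
factorˡ-≢𝟘 C≢𝟘 AB≡C refl = C≢𝟘 (sym AB≡C)

factorʳ-≢𝟘 : ∀ {A B C} → C ≢ 𝟘 → A * B ≡ C → B ≢ 𝟘
factorʳ-≢𝟘 {A} C≢𝟘 AB≡C refl = C≢𝟘 (trans (sym AB≡C) (*-zeroʳ A))

*-cancelˡ : ∀ {A B C} → A ≢ 𝟘 → A * B ≡ A * C → B ≡ C
*-cancelˡ {A} {B} {C} A≢𝟘 AB≡AC with (B + C) ≟ 𝟘
... | yes B+C≡𝟘 = +≡𝟘⇒≡ B C B+C≡𝟘
... | no  B+C≢𝟘 = ⊥-elim (*-≢𝟘 A≢𝟘 B+C≢𝟘 (begin
  A * (B + C)     ≡⟨ *-distribˡ-+ A B C ⟩
  A * B + A * C   ≡⟨ cong (_+ A * C) AB≡AC ⟩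
  A * C + A * C   ≡⟨ +-self (A * C) ⟩
  𝟘               ∎))

*-cancelʳ : ∀ {A B C} → A ≢ 𝟘 → B * A ≡ C * A → B ≡ C
*-cancelʳ {A} {B} {C} A≢𝟘 BA≡CA = *-cancelˡ A≢𝟘 (trans (*-comm A B) (trans BA≡CA (*-comm C A)))

deg≡0⇒≡𝟙 : ∀ {A} → A ≢ 𝟘 → deg A ≡ 0 → A ≡ 𝟙
deg≡0⇒≡𝟙 {𝟘}              A≢𝟘 _  = ⊥-elim (A≢𝟘 refl)
deg≡0⇒≡𝟙 {nz one}         _   _  = refl
deg≡0⇒≡𝟙 {nz (_ ,x _)}    _   ()

*≡𝟙⇒≡𝟙 : ∀ {A B} → A * B ≡ 𝟙 → A ≡ 𝟙
*≡𝟙⇒≡𝟙 {A} {B} AB≡𝟙 =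
  deg≡0⇒≡𝟙 A≢𝟘 (ℕ.m+n≡0⇒m≡0 (deg A) (trans (sym (deg-* A≢𝟘 B≢𝟘)) (cong deg AB≡𝟙)))
  where
  A≢𝟘 : A ≢ 𝟘
  A≢𝟘 = factorˡ-≢𝟘 {A} {B} (λ ()) AB≡𝟙
  B≢𝟘 : B ≢ 𝟘
  B≢𝟘 = factorʳ-≢𝟘 {A} {B} (λ ()) AB≡𝟙

nonConstant⇒≢𝟘 : ∀ {A} → NonConstant A → A ≢ 𝟘
nonConstant⇒≢𝟘 {nz _} _ ()

≢𝟘∧≢𝟙⇒nonConstant : ∀ {A} → A ≢ 𝟘 → A ≢ 𝟙 → NonConstant A
≢𝟘∧≢𝟙⇒nonConstant {𝟘}           A≢𝟘 _   = ⊥-elim (A≢𝟘 refl)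
≢𝟘∧≢𝟙⇒nonConstant {nz one}      _   A≢𝟙 = ⊥-elim (A≢𝟙 refl)
≢𝟘∧≢𝟙⇒nonConstant {nz (_ ,x _)} _   _   = tt

∣-refl : ∀ A → A ∣ A
∣-refl A = 𝟙 , *-identityʳ A

𝟙∣ : ∀ A → 𝟙 ∣ A
𝟙∣ A = A , *-identityˡ A

∣𝟘 : ∀ A → A ∣ 𝟘
∣𝟘 A = 𝟘 , *-zeroʳ A

∣-trans : ∀ {A B C} → A ∣ B → B ∣ C → A ∣ C
∣-trans {A} (X , AX≡B) (Y , BY≡C) = X * Y , trans (sym (*-assoc A X Y)) (trans (cong (_* Y) AX≡B) BY≡C)

A∣A*B : ∀ A B → A ∣ A * B
A∣A*B A B = B , refl

B∣A*B : ∀ A B → B ∣ A * B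
B∣A*B A B = A , *-comm B A

∣A∣B⇒∣A+B : ∀ {D A B} → D ∣ A → D ∣ B → D ∣ A + B
∣A∣B⇒∣A+B {D} (X , DX≡A) (Y , DY≡B) = X + Y , trans (*-distribˡ-+ D X Y) (cong₂ _+_ DX≡A DY≡B)

∣⇒≢𝟘 : ∀ {A B} → B ≢ 𝟘 → A ∣ B → A ≢ 𝟘
∣⇒≢𝟘 {A} B≢𝟘 (X , AX≡B) = factorˡ-≢𝟘 {A} {X} B≢𝟘 AX≡B

∣⇒deg≤ : ∀ {A B} → B ≢ 𝟘 → A ∣ B → deg A ℕ.≤ deg B
∣⇒deg≤ {A} {B} B≢𝟘 (X , AX≡B) = ℕ.≤-trans (ℕ.m≤m+n (deg A) (deg X))
  (ℕ.≤-reflexive (trans (sym (deg-* (factorˡ-≢𝟘 {A} {X} B≢𝟘 AX≡B) (factorʳ-≢𝟘 {A} {X} B≢𝟘 AX≡B))) (cong deg AX≡B)))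

∣∧deg≡⇒≡ : ∀ {A B} → B ≢ 𝟘 → A ∣ B → deg A ≡ deg B → A ≡ B
∣∧deg≡⇒≡ {A} {B} B≢𝟘 (X , AX≡B) degA≡degB = begin
  A       ≡⟨ *-identityʳ A ⟨
  A * 𝟙   ≡⟨ cong (A *_) X≡𝟙 ⟨
  A * X   ≡⟨ AX≡B ⟩
  B       ∎
  where
  A≢𝟘 : A ≢ 𝟘
  A≢𝟘 = factorˡ-≢𝟘 {A} {X} B≢𝟘 AX≡B
  X≢𝟘 : X ≢ 𝟘
  X≢𝟘 = factorʳ-≢𝟘 {A} {X} B≢𝟘 AX≡B
  X≡𝟙 : X ≡ 𝟙
  X≡𝟙 = deg≡0⇒≡𝟙 X≢𝟘 (ℕ.+-cancelˡ-≡ (deg A) (deg X) 0 (begin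
    deg A ℕ.+ deg X   ≡⟨ deg-* A≢𝟘 X≢𝟘 ⟨
    deg (A * X)       ≡⟨ cong deg AX≡B ⟩
    deg B             ≡⟨ degA≡degB ⟨
    deg A             ≡⟨ ℕ.+-identityʳ (deg A) ⟨
    deg A ℕ.+ 0       ∎))

∣𝟙⇒≡𝟙 : ∀ {A} → A ∣ 𝟙 → A ≡ 𝟙
∣𝟙⇒≡𝟙 (_ , AX≡𝟙) = *≡𝟙⇒≡𝟙 AX≡𝟙

coprime-𝟙ˡ : ∀ A → Coprime 𝟙 A
coprime-𝟙ˡ _ _ E∣𝟙 _ = ∣𝟙⇒≡𝟙 E∣𝟙

coprime-𝟙ʳ : ∀ A → Coprime A 𝟙
coprime-𝟙ʳ _ _ _ E∣𝟙 = ∣𝟙⇒≡𝟙 E∣𝟙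

irreducible-divisor : ∀ {P D} → Irreducible P → D ∣ P → D ≡ 𝟙 ⊎ D ≡ P
irreducible-divisor {D = D} (_ , factors) (C , DC≡P) with factors D C DC≡P
... | inj₁ D≡𝟙 = inj₁ D≡𝟙
... | inj₂ C≡𝟙 = inj₂ (trans (sym (*-identityʳ D)) (trans (cong (D *_) (sym C≡𝟙)) DC≡P))

irreducible⇒≢𝟘 : ∀ {P} → Irreducible P → P ≢ 𝟘
irreducible⇒≢𝟘 (nonConstant , _) = nonConstant⇒≢𝟘 nonConstant

irreducible⇒≢𝟙 : ∀ {P} → Irreducible P → P ≢ 𝟙
irreducible⇒≢𝟙 (() , _) refl

-- Division with remainder and Euclid's lemma

infix 4 _≺_
data _≺_ (R B : Poly) : Set where
  𝟘≺   : R ≡ 𝟘 → R ≺ B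
  deg< : deg R ℕ.< deg B → R ≺ B

deg-cons-nz : ∀ b r → deg (cons b (nz r)) ≡ suc (deg⁺ r)
deg-cons-nz false _ = refl
deg-cons-nz true  _ = refl

cons-≺ : ∀ b c R q → R ≺ nz q → cons b R ≺ nz (c ,x q)
cons-≺ false _ 𝟘      _ _            = 𝟘≺ refl
cons-≺ true  _ 𝟘      _ _            = deg< (s≤s z≤n)
cons-≺ b     _ (nz r) _ (deg< r<q)   = deg< (subst (ℕ._< _) (sym (deg-cons-nz b r)) (s≤s r<q))

equal-degree⁺-≺ : ∀ p q → deg⁺ p ≡ deg⁺ q → nz p + nz q ≺ nz q
equal-degree⁺-≺ one      one      _     = 𝟘≺ refl
equal-degree⁺-≺ (b ,x p) (c ,x q) p≡q =
  cons-≺ (b xor c) c (add⁺ p q) q (equal-degree⁺-≺ p q (ℕ.suc-injective p≡q))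

equal-degree-≺ : ∀ {X B} → X ≢ 𝟘 → B ≢ 𝟘 → deg X ≡ deg B → X + B ≺ B
equal-degree-≺ {𝟘}           X≢𝟘 _   _ = ⊥-elim (X≢𝟘 refl)
equal-degree-≺ {nz _} {𝟘}    _   B≢𝟘 _ = ⊥-elim (B≢𝟘 refl)
equal-degree-≺ {nz p} {nz q} _   _     = equal-degree⁺-≺ p q

cons-≺-or-equal-degree : ∀ a R B → B ≢ 𝟘 → R ≺ B →
                         cons a R ≺ B ⊎ (cons a R ≢ 𝟘 × deg (cons a R) ≡ deg B)
cons-≺-or-equal-degree false 𝟘      _ _   _          = inj₁ (𝟘≺ refl)
cons-≺-or-equal-degree true  𝟘      𝟘             B≢𝟘 _ = ⊥-elim (B≢𝟘 refl)
cons-≺-or-equal-degree true  𝟘      (nz one)      _   _ = inj₂ ((λ ()) , refl)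
cons-≺-or-equal-degree true  𝟘      (nz (_ ,x _)) _   _ = inj₁ (deg< (s≤s z≤n))
cons-≺-or-equal-degree a     (nz r) B _   (deg< r<B) with ℕ.m≤n⇒m<n∨m≡n r<B
... | inj₁ r+1<B = inj₁ (deg< (subst (ℕ._< deg B) (sym (deg-cons-nz a r)) r+1<B))
... | inj₂ r+1≡B = inj₂ (cons-nz-≢𝟘 a , trans (deg-cons-nz a r) r+1≡B)
  where
  cons-nz-≢𝟘 : ∀ a → cons a (nz r) ≢ 𝟘
  cons-nz-≢𝟘 false ()
  cons-nz-≢𝟘 true  ()

divMod : ∀ B → B ≢ 𝟘 → ∀ A → ∃₂ λ Q R → A ≡ Q * B + R × R ≺ B
divMod B B≢𝟘 = tail-induction (λ A → ∃₂ λ Q R → A ≡ Q * B + R × R ≺ B) (𝟘 , 𝟘 , refl , 𝟘≺ refl) step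
  where
  shift-divMod : ∀ A Q R → tail A ≡ Q * B + R → A ≡ cons false Q * B + cons (head A) R
  shift-divMod A Q R tailA≡ = begin
    A                                        ≡⟨ cons-head-tail A ⟨
    cons (head A) (tail A)                   ≡⟨ cong (cons (head A)) tailA≡ ⟩
    cons (head A) (Q * B + R)                ≡⟨ cons-+-cons false (head A) (Q * B) R ⟨
    cons false (Q * B) + cons (head A) R     ≡⟨ cong (_+ cons (head A) R) (shift-* Q B) ⟨
    cons false Q * B + cons (head A) R       ∎
  reduce : ∀ Q C → Q * B + C ≡ (Q + 𝟙) * B + (C + B)
  reduce Q C = begin
    Q * B + C                    ≡⟨ +-identityʳ (Q * B + C) ⟨
    Q * B + C + 𝟘                ≡⟨ cong (Q * B + C +_) (+-self B) ⟨
    Q * B + C + (B + B)          ≡⟨ regroup Q C B ⟩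
    (Q + 𝟙) * B + (C + B)        ∎
    where
    regroup : ∀ Q C B → Q * B + C + (B + B) ≡ (Q + 𝟙) * B + (C + B)
    regroup = solve-∀ ring
  step : ∀ A → (∃₂ λ Q R → tail A ≡ Q * B + R × R ≺ B) → ∃₂ λ Q R → A ≡ Q * B + R × R ≺ B
  step A (Q , R , tailA≡ , R≺B) with cons-≺-or-equal-degree (head A) R B B≢𝟘 R≺B
  ... | inj₁ R′≺B =
    cons false Q , cons (head A) R , shift-divMod A Q R tailA≡ , R′≺B
  ... | inj₂ (R′≢𝟘 , degR′≡degB) =
    cons false Q + 𝟙 , cons (head A) R + B ,
    trans (shift-divMod A Q R tailA≡) (reduce (cons false Q) (cons (head A) R)) ,
    equal-degree-≺ R′≢𝟘 B≢𝟘 degR′≡degB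

size : Poly → ℕ
size 𝟘      = 0
size (nz p) = suc (deg⁺ p)

≺⇒size< : ∀ {R B} → B ≢ 𝟘 → R ≺ B → size R ℕ.< size B
≺⇒size< {_}    {𝟘}    B≢𝟘 _          = ⊥-elim (B≢𝟘 refl)
≺⇒size< {𝟘}    {nz _} _   _          = s≤s z≤n
≺⇒size< {nz _} {nz _} _   (deg< R<B) = s≤s R<B

bézout : ∀ n X Y → size Y ℕ.≤ n → ∃ λ D → D ∣ X × D ∣ Y × ∃₂ λ U V → D ≡ U * X + V * Y
bézout _       X 𝟘      _ = X , ∣-refl X , ∣𝟘 X , 𝟙 , 𝟘 , sym (trans (+-identityʳ (𝟙 * X)) (*-identityˡ X))
bézout (suc n) X (nz q) (s≤s sizeY≤n) with divMod (nz q) (λ ()) X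
... | Q , R , X≡QY+R , R≺Y with bézout n (nz q) R (ℕ.≤-trans (s≤s⁻¹ (≺⇒size< (λ ()) R≺Y)) sizeY≤n)
... | D , D∣Y , D∣R , U , V , D≡UY+VR = D , D∣X , D∣Y , V , U + V * Q , D≡VX+[U+VQ]Y
  where
  Y : Poly
  Y = nz q
  D∣X : D ∣ X
  D∣X = subst (D ∣_) (sym X≡QY+R) (∣A∣B⇒∣A+B {D} (∣-trans {D} {Y} D∣Y (B∣A*B Q Y)) D∣R)
  regroup : ∀ U V Q X Y → U * Y + V * (Q * Y + X) ≡ V * X + (U + V * Q) * Y
  regroup = solve-∀ ring
  D≡VX+[U+VQ]Y : D ≡ V * X + (U + V * Q) * Y
  D≡VX+[U+VQ]Y = begin
    D                          ≡⟨ D≡UY+VR ⟩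
    U * Y + V * R              ≡⟨ cong (λ Z → U * Y + V * Z) (x≡y+z⇒z≡y+x {Y = Q * Y} X≡QY+R) ⟩
    U * Y + V * (Q * Y + X)    ≡⟨ regroup U V Q X Y ⟩
    V * X + (U + V * Q) * Y    ∎

euclidsLemma : ∀ {P A B} → Irreducible P → P ∣ A * B → P ∣ A ⊎ P ∣ B
euclidsLemma {P} {A} {B} P-irr P∣AB with bézout (size A) P A ℕ.≤-refl
... | D , D∣P , D∣A , U , V , D≡UP+VA with irreducible-divisor P-irr D∣P
... | inj₂ D≡P = inj₁ (subst (_∣ A) D≡P D∣A)
... | inj₁ D≡𝟙 = inj₂ (subst (P ∣_) B≡ (∣A∣B⇒∣A+B {P} (∣-trans {P} (B∣A*B U P) (A∣A*B (U * P) B)) P∣VAB))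
  where
  regroup : ∀ U P V A B → U * P * B + V * (A * B) ≡ (U * P + V * A) * B
  regroup = solve-∀ ring
  B≡ : U * P * B + V * (A * B) ≡ B
  B≡ = begin
    U * P * B + V * (A * B)    ≡⟨ regroup U P V A B ⟩
    (U * P + V * A) * B        ≡⟨ cong (_* B) (trans (sym D≡UP+VA) D≡𝟙) ⟩
    𝟙 * B                      ≡⟨ *-identityˡ B ⟩
    B                          ∎
  P∣VAB : P ∣ V * (A * B)
  P∣VAB = ∣-trans {P} {A * B} P∣AB (B∣A*B V (A * B))

==⇒≡ : ∀ {A B} → T (A == B) → A ≡ B
==⇒≡ {A} {B} = toWitness {a? = A ≟ B}

≡⇒== : ∀ {A B} → A ≡ B → T (A == B)
≡⇒== {A} {B} = fromWitness {a? = A ≟ B}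

≢⇒not== : ∀ {A B} → A ≢ B → T (not (A == B))
≢⇒not== {A} {B} = fromWitnessFalse {a? = A ≟ B}

¬T⇒T-not : ∀ {b} → ¬ T b → T (not b)
¬T⇒T-not {false} _  = tt
¬T⇒T-not {true}  ¬t = ¬t tt

T-not⇒¬T : ∀ {b} → T (not b) → ¬ T b
T-not⇒¬T {false} _ ()

¬T-not⇒T : ∀ {b} → ¬ T (not b) → T b
¬T-not⇒T {false} ¬t = ¬t tt
¬T-not⇒T {true}  _  = tt

polysOfDeg-complete : ∀ p → p ∈ polysOfDeg (deg⁺ p)
polysOfDeg-complete one          = here refl
polysOfDeg-complete (false ,x p) = ∈-++⁺ˡ (∈-map⁺ (false ,x_) (polysOfDeg-complete p))
polysOfDeg-complete (true ,x p)  =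
  ∈-++⁺ʳ (map (false ,x_) (polysOfDeg (deg⁺ p))) (∈-map⁺ (true ,x_) (polysOfDeg-complete p))

polysOfDeg-sound : ∀ n {p} → p ∈ polysOfDeg n → deg⁺ p ≡ n
polysOfDeg-sound zero    (here refl) = refl
polysOfDeg-sound (suc n) p∈ with ∈-++⁻ (map (false ,x_) (polysOfDeg n)) p∈
... | inj₁ p∈₀ with ∈-map⁻ (false ,x_) p∈₀
...   | q , q∈ , refl = cong suc (polysOfDeg-sound n q∈)
polysOfDeg-sound (suc n) p∈ | inj₂ p∈₁ with ∈-map⁻ (true ,x_) p∈₁
...   | q , q∈ , refl = cong suc (polysOfDeg-sound n q∈)

polysOfDeg-unique : ∀ n → Unique (polysOfDeg n)
polysOfDeg-unique zero    = All.[] ∷ []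
polysOfDeg-unique (suc n) =
  Unique.++⁺ (Unique.map⁺ ,x-injective (polysOfDeg-unique n)) (Unique.map⁺ ,x-injective (polysOfDeg-unique n)) disjoint
  where
  ,x-injective : ∀ {b p q} → (b ,x p) ≡ (b ,x q) → p ≡ q
  ,x-injective refl = refl
  disjoint : ∀ {v} → ¬ (v ∈ map (false ,x_) (polysOfDeg n) × v ∈ map (true ,x_) (polysOfDeg n))
  disjoint (v∈₀ , v∈₁) with ∈-map⁻ (false ,x_) v∈₀ | ∈-map⁻ (true ,x_) v∈₁
  ... | _ , _ , refl | _ , _ , ()

polysUpTo-complete : ∀ n {A} → A ≢ 𝟘 → deg A ℕ.≤ n → A ∈ polysUpTo n
polysUpTo-complete _       {𝟘}           A≢𝟘 _ = ⊥-elim (A≢𝟘 refl)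
polysUpTo-complete zero    {nz one}      _   _ = here refl
polysUpTo-complete (suc n) {nz p}        _   p≤ with ℕ.m≤n⇒m<n∨m≡n p≤
... | inj₁ p< = ∈-++⁺ˡ (polysUpTo-complete n (λ ()) (s≤s⁻¹ p<))
... | inj₂ p≡ = ∈-++⁺ʳ (polysUpTo n) (∈-map⁺ nz (subst (λ k → p ∈ polysOfDeg k) p≡ (polysOfDeg-complete p)))

polysUpTo-deg≤ : ∀ n {A} → A ∈ polysUpTo n → deg A ℕ.≤ n
polysUpTo-deg≤ zero    (here refl) = z≤n
polysUpTo-deg≤ (suc n) A∈ with ∈-++⁻ (polysUpTo n) A∈
... | inj₁ A∈≤n = ℕ.m≤n⇒m≤1+n (polysUpTo-deg≤ n A∈≤n)
... | inj₂ A∈=n with ∈-map⁻ nz A∈=n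
...   | q , q∈ , refl = ℕ.≤-reflexive (polysOfDeg-sound (suc n) q∈)

polysUpTo-unique : ∀ n → Unique (polysUpTo n)
polysUpTo-unique zero    = Unique.map⁺ nz-injective (polysOfDeg-unique zero)
  where
  nz-injective : ∀ {p q} → nz p ≡ nz q → p ≡ q
  nz-injective refl = refl
polysUpTo-unique (suc n) =
  Unique.++⁺ (polysUpTo-unique n) (Unique.map⁺ nz-injective (polysOfDeg-unique (suc n))) disjoint
  where
  nz-injective : ∀ {p q} → nz p ≡ nz q → p ≡ q
  nz-injective refl = refl
  disjoint : ∀ {v} → ¬ (v ∈ polysUpTo n × v ∈ map nz (polysOfDeg (suc n)))
  disjoint (v∈≤n , v∈=n) with ∈-map⁻ nz v∈=n
  ... | q , q∈ , refl = ℕ.<-irrefl (polysOfDeg-sound (suc n) q∈) (s≤s (polysUpTo-deg≤ n v∈≤n))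

divisor∈polysUpTo : ∀ {A B} → A ≢ 𝟘 → B ∣ A → B ∈ polysUpTo (deg A)
divisor∈polysUpTo {A} {B} A≢𝟘 B∣A = polysUpTo-complete (deg A) (∣⇒≢𝟘 {B} A≢𝟘 B∣A) (∣⇒deg≤ {B} A≢𝟘 B∣A)

factorisation? : (A : Poly) (DC : Poly × Poly) → Dec (T ((proj₁ DC * proj₂ DC) == A))
factorisation? A DC = T? ((proj₁ DC * proj₂ DC) == A)

divPairs-complete : ∀ {A D C} → A ≢ 𝟘 → D * C ≡ A → (D , C) ∈ divPairs A
divPairs-complete {A} {D} {C} A≢𝟘 DC≡A = ∈-filter⁺ (factorisation? A)
  (∈-cartesianProduct⁺ (divisor∈polysUpTo {A} {D} A≢𝟘 (C , DC≡A))
                       (divisor∈polysUpTo {A} {C} A≢𝟘 (D , trans (*-comm C D) DC≡A)))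
  (≡⇒== DC≡A)

divPairs-sound : ∀ {A DC} → DC ∈ divPairs A → proj₁ DC * proj₂ DC ≡ A
divPairs-sound {A} DC∈ =
  ==⇒≡ (proj₂ (∈-filter⁻ (factorisation? A) {xs = cartesianProduct (polysUpTo (deg A)) (polysUpTo (deg A))} DC∈))

divPairs-unique : ∀ A → Unique (divPairs A)
divPairs-unique A =
  Unique.filter⁺ (factorisation? A) (Unique.cartesianProduct⁺ (polysUpTo-unique (deg A)) (polysUpTo-unique (deg A)))

∈-divisors⁺ : ∀ {A D} → A ≢ 𝟘 → D ∣ A → D ∈ divisors A
∈-divisors⁺ A≢𝟘 (C , DC≡A) = ∈-map⁺ proj₁ (divPairs-complete A≢𝟘 DC≡A)

∈-divisors⁻ : ∀ {A D} → D ∈ divisors A → D ∣ A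
∈-divisors⁻ D∈ with ∈-map⁻ proj₁ D∈
... | (D , C) , DC∈ , refl = C , divPairs-sound DC∈

divides?-sound : ∀ {B A} → T (divides? B A) → B ∣ A
divides?-sound {B} {A} t with find (any⁻ (λ C → (B * C) == A) (polysUpTo (deg A)) t)
... | C , _ , BC==A = C , ==⇒≡ BC==A

divides?-complete : ∀ {B A} → A ≢ 𝟘 → B ∣ A → T (divides? B A)
divides?-complete {B} {A} A≢𝟘 (C , BC≡A) = any⁺ (λ C → (B * C) == A)
  (lose (divisor∈polysUpTo {A} {C} A≢𝟘 (B , trans (*-comm C B) BC≡A)) (≡⇒== BC≡A))

irreducible?-complete : ∀ {P} → Irreducible P → T (irreducible? P)
irreducible?-complete {nz (b ,x p)} P-irr = all⁻ (λ D → (D == 𝟙) ∨ (D == P)) (All.tabulate trivial-divisor)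
  where
  P : Poly
  P = nz (b ,x p)
  trivial-divisor : ∀ {D} → D ∈ divisors P → T ((D == 𝟙) ∨ (D == P))
  trivial-divisor {D} D∈ with irreducible-divisor P-irr (∈-divisors⁻ {P} {D} D∈)
  ... | inj₁ D≡𝟙 = Equivalence.from (T-∨ {D == 𝟙}) (inj₁ (≡⇒== D≡𝟙))
  ... | inj₂ D≡P = Equivalence.from (T-∨ {D == 𝟙}) (inj₂ (≡⇒== D≡P))

irreducible?-sound : ∀ {P} → T (irreducible? P) → Irreducible P
irreducible?-sound {nz (b ,x p)} t = tt , factors
  where
  P : Poly
  P = nz (b ,x p)
  factors : ∀ B C → B * C ≡ P → B ≡ 𝟙 ⊎ C ≡ 𝟙
  factors B C BC≡P
    with Equivalence.to (T-∨ {B == 𝟙})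
           (All.lookup (all⁺ (λ D → (D == 𝟙) ∨ (D == P)) (divisors P) t) (∈-divisors⁺ {P} {B} (λ ()) (C , BC≡P)))
  ... | inj₁ B==𝟙 = inj₁ (==⇒≡ B==𝟙)
  ... | inj₂ B==P = inj₂ (*-cancelˡ {P} (λ ()) (begin
    P * C    ≡⟨ cong (_* C) (==⇒≡ B==P) ⟨
    B * C    ≡⟨ BC≡P ⟩
    P        ≡⟨ *-identityʳ P ⟨
    P * 𝟙    ∎))

nonIrreducible⇒properDivisor : ∀ {A} → NonConstant A → ¬ T (irreducible? A) → ∃ λ D → D ∣ A × D ≢ 𝟙 × D ≢ A
nonIrreducible⇒properDivisor {nz (b ,x p)} _ ¬t =
  properDivisor (find (¬All⇒Any¬ (T? ∘ trivial?) (divisors A) (λ all-trivial → ¬t (all⁻ trivial? all-trivial))))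
  where
  A : Poly
  A = nz (b ,x p)
  trivial? : Poly → Bool
  trivial? D = (D == 𝟙) ∨ (D == A)
  properDivisor : (∃ λ D → D ∈ divisors A × ¬ T (trivial? D)) → ∃ λ D → D ∣ A × D ≢ 𝟙 × D ≢ A
  properDivisor (D , D∈ , ¬trivial) =
    D , ∈-divisors⁻ {A} {D} D∈ , (λ D≡𝟙 → ¬trivial (Equivalence.from (T-∨ {D == 𝟙}) (inj₁ (≡⇒== D≡𝟙))))
                               , (λ D≡A → ¬trivial (Equivalence.from (T-∨ {D == 𝟙}) (inj₂ (≡⇒== D≡A))))

squareFree?-complete : ∀ {S} → SquareFree S → T (squareFree? S)
squareFree?-complete {S} (_ , noSquare) = all⁻ noSquare? {xs = polysUpTo (deg S)} (All.tabulate λ {P} _ →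
  ¬T⇒T-not λ t → let P-irr , P²∣S = Equivalence.to (T-∧ {irreducible? P}) t in
    noSquare P (irreducible?-sound P-irr) (divides?-sound {P * P} {S} P²∣S))
  where
  noSquare? : Poly → Bool
  noSquare? P = not (irreducible? P ∧ divides? (P * P) S)

squareFree?-sound : ∀ {S} → S ≢ 𝟘 → T (squareFree? S) → SquareFree S
squareFree?-sound {S} S≢𝟘 t = S≢𝟘 , λ P P-irr P²∣S →
  T-not⇒¬T (All.lookup (all⁺ noSquare? (polysUpTo (deg S)) t)
                       (divisor∈polysUpTo {S} {P} S≢𝟘 (∣-trans {P} (A∣A*B P P) P²∣S)))
           (Equivalence.from (T-∧ {irreducible? P}) (irreducible?-complete P-irr , divides?-complete {P * P} S≢𝟘 P²∣S))
  where
  noSquare? : Poly → Bool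
  noSquare? P = not (irreducible? P ∧ divides? (P * P) S)

¬squareFree?⇒squareFactor : ∀ {S} → ¬ T (squareFree? S) → ∃ λ P → Irreducible P × P * P ∣ S
¬squareFree?⇒squareFactor {S} ¬t =
  squareFactor (find (¬All⇒Any¬ (T? ∘ noSquare?) (polysUpTo (deg S)) (λ all-noSquare → ¬t (all⁻ noSquare? all-noSquare))))
  where
  noSquare? : Poly → Bool
  noSquare? P = not (irreducible? P ∧ divides? (P * P) S)
  squareFactor : (∃ λ P → P ∈ polysUpTo (deg S) × ¬ T (noSquare? P)) → ∃ λ P → Irreducible P × P * P ∣ S
  squareFactor (P , _ , ¬noSquare) =
    let P-irr , P²∣S = Equivalence.to (T-∧ {irreducible? P}) (¬T-not⇒T ¬noSquare)
    in P , irreducible?-sound P-irr , divides?-sound {P * P} {S} P²∣S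

coprime?-sound : ∀ {A B} → A ≢ 𝟘 → B ≢ 𝟘 → T (coprime? A B) → Coprime A B
coprime?-sound {A} {B} A≢𝟘 B≢𝟘 t E E∣A E∣B
  with Equivalence.to (T-∨ {not (divides? E A ∧ divides? E B)})
         (All.lookup (all⁺ (λ E → not (divides? E A ∧ divides? E B) ∨ (E == 𝟙)) (polysUpTo (deg A)) t)
                     (divisor∈polysUpTo {A} {E} A≢𝟘 E∣A))
... | inj₁ notBoth = ⊥-elim (T-not⇒¬T notBoth
                       (Equivalence.from (T-∧ {divides? E A}) (divides?-complete {E} A≢𝟘 E∣A , divides?-complete {E} B≢𝟘 E∣B)))
... | inj₂ E==𝟙    = ==⇒≡ E==𝟙

coprime?-complete : ∀ {A B} → Coprime A B → T (coprime? A B)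
coprime?-complete {A} {B} coprime = all⁻ onlyUnit? {xs = polysUpTo (deg A)} (All.tabulate λ {E} _ → onlyUnit E)
  where
  onlyUnit? : Poly → Bool
  onlyUnit? E = not (divides? E A ∧ divides? E B) ∨ (E == 𝟙)
  onlyUnit : ∀ E → T (onlyUnit? E)
  onlyUnit E with T? (divides? E A ∧ divides? E B)
  ... | no  ¬both = Equivalence.from (T-∨ {not (divides? E A ∧ divides? E B)}) (inj₁ (¬T⇒T-not ¬both))
  ... | yes both  = let E∣A , E∣B = Equivalence.to (T-∧ {divides? E A}) both in
    Equivalence.from (T-∨ {not (divides? E A ∧ divides? E B)})
      (inj₂ (≡⇒== (coprime E (divides?-sound {E} {A} E∣A) (divides?-sound {E} {B} E∣B))))

sumP-↭ : ∀ {xs ys} → xs ↭ ys → sumP xs ≡ sumP ys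
sumP-↭ xs↭ys = ↭ₛ.foldr-commMonoid (setoid Poly)
  (IsCommutativeRing.+-isCommutativeMonoid +-*-isCommutativeRing) (↭⇒↭ₛ xs↭ys)

sumP-++ : ∀ xs ys → sumP (xs ++ ys) ≡ sumP xs + sumP ys
sumP-++ []       ys = refl
sumP-++ (x ∷ xs) ys = trans (cong (x +_) (sumP-++ xs ys)) (sym (+-assoc x (sumP xs) (sumP ys)))

sumP-map-*ˡ : ∀ P xs → sumP (map (P *_) xs) ≡ P * sumP xs
sumP-map-*ˡ P []       = sym (*-zeroʳ P)
sumP-map-*ˡ P (x ∷ xs) = trans (cong (P * x +_) (sumP-map-*ˡ P xs)) (sym (*-distribˡ-+ P x (sumP xs)))

unique-sameElements⇒↭ : ∀ {X : Set} {xs ys : List X} → Unique xs → Unique ys →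
                        (∀ {x} → x ∈ xs → x ∈ ys) → (∀ {x} → x ∈ ys → x ∈ xs) → xs ↭ ys
unique-sameElements⇒↭ xs! ys! xs⊆ys ys⊆xs = ∼bag⇒↭ (unique∧set⇒bag xs! ys! (mk⇔ xs⊆ys ys⊆xs))

sumP-map-reindex : ∀ {X : Set} (h : X → Poly) {xs ys : List X} → Unique xs → Unique ys →
                   (∀ {x} → x ∈ xs → x ∈ ys) → (∀ {x} → x ∈ ys → x ∈ xs) →
                   sumP (map h xs) ≡ sumP (map h ys)
sumP-map-reindex h xs! ys! xs⊆ys ys⊆xs = sumP-↭ (↭.map⁺ h (unique-sameElements⇒↭ xs! ys! xs⊆ys ys⊆xs))

sumP-map-≡𝟘 : ∀ {X : Set} (h : X → Poly) xs → (∀ {y} → y ∈ xs → h y ≡ 𝟘) → sumP (map h xs) ≡ 𝟘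
sumP-map-≡𝟘 h []       _     = refl
sumP-map-≡𝟘 h (y ∷ xs) h≡𝟘 = cong₂ _+_ (h≡𝟘 (here refl)) (sumP-map-≡𝟘 h xs (h≡𝟘 ∘ there))

sumP-map-single : ∀ {X : Set} (h : X → Poly) xs {x} → Unique xs → x ∈ xs →
                  (∀ {y} → y ∈ xs → y ≢ x → h y ≡ 𝟘) → sumP (map h xs) ≡ h x
sumP-map-single h (y ∷ xs) (y∉xs ∷ _) (here refl) others≡𝟘 =
  trans (cong (h y +_) (sumP-map-≡𝟘 h xs λ y′∈ → others≡𝟘 (there y′∈) λ { refl → All.lookup y∉xs y′∈ refl }))
        (+-identityʳ (h y))
sumP-map-single h (y ∷ xs) (y∉xs ∷ xs!) (there x∈) others≡𝟘 =
  cong₂ _+_ (others≡𝟘 (here refl) λ { refl → All.lookup y∉xs x∈ refl })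
            (sumP-map-single h xs xs! x∈ (others≡𝟘 ∘ there))

∈-filter-divPairs⁺ : ∀ {A} (q : Poly × Poly → Bool) {D C} → A ≢ 𝟘 → D * C ≡ A → T (q (D , C)) →
                     (D , C) ∈ filterᵇ q (divPairs A)
∈-filter-divPairs⁺ q A≢𝟘 DC≡A qDC = ∈-filter⁺ (T? ∘ q) (divPairs-complete A≢𝟘 DC≡A) qDC

∈-filter-divPairs⁻ : ∀ {A} (q : Poly × Poly → Bool) {DC} → DC ∈ filterᵇ q (divPairs A) →
                     proj₁ DC * proj₂ DC ≡ A × T (q DC)
∈-filter-divPairs⁻ {A} q DC∈ with ∈-filter⁻ (T? ∘ q) {xs = divPairs A} DC∈
... | DC∈divPairs , qDC = divPairs-sound {A} DC∈divPairs , qDC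

sumP-map-divPairs : ∀ {A} (h : Poly × Poly → Poly) {L} → A ≢ 𝟘 → Unique L →
                    (∀ {D C} → D * C ≡ A → (D , C) ∈ L) → All (λ DC → proj₁ DC * proj₂ DC ≡ A) L →
                    sumP (map h (divPairs A)) ≡ sumP (map h L)
sumP-map-divPairs {A} h A≢𝟘 L! complete sound = sumP-map-reindex h (divPairs-unique A) L!
  (λ DC∈ → complete (divPairs-sound {A} DC∈)) (λ DC∈ → divPairs-complete A≢𝟘 (All.lookup sound DC∈))

sumP-map-filter-divPairs : ∀ {A} (q : Poly × Poly → Bool) (h : Poly × Poly → Poly) {L} → A ≢ 𝟘 → Unique L →
                           (∀ {D C} → D * C ≡ A → T (q (D , C)) → (D , C) ∈ L) →
                           All (λ DC → proj₁ DC * proj₂ DC ≡ A × T (q DC)) L →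
                           sumP (map h (filterᵇ q (divPairs A))) ≡ sumP (map h L)
sumP-map-filter-divPairs {A} q h A≢𝟘 L! complete sound = sumP-map-reindex h (Unique.filter⁺ (T? ∘ q) (divPairs-unique A)) L!
  (λ DC∈ → let DC≡A , qDC = ∈-filter-divPairs⁻ q DC∈ in complete DC≡A qDC)
  (λ DC∈ → let DC≡A , qDC = All.lookup sound DC∈ in ∈-filter-divPairs⁺ q A≢𝟘 DC≡A qDC)

-- Irreducible factors and square-free polynomials

∣∧≢⇒deg< : ∀ {A B} → B ≢ 𝟘 → A ∣ B → A ≢ B → deg A ℕ.< deg B
∣∧≢⇒deg< {A} B≢𝟘 A∣B A≢B = ℕ.≤∧≢⇒< (∣⇒deg≤ {A} B≢𝟘 A∣B) (A≢B ∘ ∣∧deg≡⇒≡ {A} B≢𝟘 A∣B)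

irreducible-factor : ∀ {A} → NonConstant A → ∃ λ P → Irreducible P × P ∣ A
irreducible-factor {A} = go (suc (deg A)) ℕ.≤-refl
  where
  go : ∀ n {A} → deg A ℕ.< n → NonConstant A → ∃ λ P → Irreducible P × P ∣ A
  go (suc n) {A} degA<1+n A-nc with T? (irreducible? A)
  ... | yes irreducible = A , irreducible?-sound irreducible , ∣-refl A
  ... | no  reducible   =
    let A≢𝟘 : A ≢ 𝟘
        A≢𝟘 = nonConstant⇒≢𝟘 A-nc
        D , D∣A , D≢𝟙 , D≢A = nonIrreducible⇒properDivisor A-nc reducible
        P , P-irr , P∣D = go n (ℕ.<-≤-trans (∣∧≢⇒deg< {D} A≢𝟘 D∣A D≢A) (s≤s⁻¹ degA<1+n))
                              (≢𝟘∧≢𝟙⇒nonConstant (∣⇒≢𝟘 {D} A≢𝟘 D∣A) D≢𝟙)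
    in P , P-irr , ∣-trans {P} {D} P∣D D∣A

factor-induction : (Pr : Poly → Set) → Pr 𝟙 →
                   (∀ {P Q} → Irreducible P → Q ≢ 𝟘 → Pr Q → Pr (P * Q)) →
                   ∀ {A} → A ≢ 𝟘 → Pr A
factor-induction Pr Pr𝟙 Pr-* {A} = go (suc (deg A)) ℕ.≤-refl
  where
  go : ∀ n {A} → deg A ℕ.< n → A ≢ 𝟘 → Pr A
  go (suc n) {A} degA<1+n A≢𝟘 with A ≟ 𝟙
  ... | yes refl = Pr𝟙
  ... | no  A≢𝟙  =
    let P , P-irr , Q , PQ≡A = irreducible-factor (≢𝟘∧≢𝟙⇒nonConstant A≢𝟘 A≢𝟙)
        Q≢𝟘 : Q ≢ 𝟘
        Q≢𝟘 = factorʳ-≢𝟘 {P} A≢𝟘 PQ≡A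
        Q≢A : Q ≢ A
        Q≢A Q≡A = irreducible⇒≢𝟙 P-irr (*-cancelʳ Q≢𝟘 (trans PQ≡A (trans (sym Q≡A) (sym (*-identityˡ Q)))))
        degQ<n : deg Q ℕ.< n
        degQ<n = ℕ.<-≤-trans (∣∧≢⇒deg< {Q} A≢𝟘 (P , trans (*-comm Q P) PQ≡A) Q≢A) (s≤s⁻¹ degA<1+n)
    in subst Pr PQ≡A (Pr-* P-irr Q≢𝟘 (go n degQ<n Q≢𝟘))

square-≢𝟙 : ∀ {P} → Irreducible P → P * P ≢ 𝟙
square-≢𝟙 P-irr P²≡𝟙 = irreducible⇒≢𝟙 P-irr (*≡𝟙⇒≡𝟙 P²≡𝟙)

irreducible-≢-square : ∀ {P} → Irreducible P → P ≢ P * P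
irreducible-≢-square {P} P-irr P≡P² =
  irreducible⇒≢𝟙 P-irr (sym (*-cancelˡ (irreducible⇒≢𝟘 P-irr) (trans (*-identityʳ P) P≡P²)))

factorisationsOfIrreducible : Poly → List (Poly × Poly)
factorisationsOfIrreducible P = (𝟙 , P) ∷ (P , 𝟙) ∷ []

factorisationsOfSquare : Poly → List (Poly × Poly)
factorisationsOfSquare P = (𝟙 , P * P) ∷ (P , P) ∷ (P * P , 𝟙) ∷ []

∈-factorisationsOfIrreducible : ∀ {P D C} → Irreducible P → D * C ≡ P → (D , C) ∈ factorisationsOfIrreducible P
∈-factorisationsOfIrreducible {P} {D} {C} P-irr DC≡P with irreducible-divisor {P} {D} P-irr (C , DC≡P)
... | inj₁ refl = here (cong (𝟙 ,_) (trans (sym (*-identityˡ C)) DC≡P))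
... | inj₂ refl = there (here (cong (P ,_) (*-cancelˡ (irreducible⇒≢𝟘 P-irr) (trans DC≡P (sym (*-identityʳ P))))))

∈-factorisationsOfSquare : ∀ {P D C} → Irreducible P → D * C ≡ P * P → (D , C) ∈ factorisationsOfSquare P
∈-factorisationsOfSquare {P} {D} {C} P-irr DC≡P² with euclidsLemma {P} {D} {C} P-irr (P , sym DC≡P²)
... | inj₁ (D′ , PD′≡D) with ∈-factorisationsOfIrreducible {P} {D′} {C} P-irr (*-cancelˡ (irreducible⇒≢𝟘 P-irr) (begin
      P * (D′ * C)   ≡⟨ *-assoc P D′ C ⟨
      P * D′ * C     ≡⟨ cong (_* C) PD′≡D ⟩
      D * C          ≡⟨ DC≡P² ⟩
      P * P          ∎))
...   | here refl         = there (here (cong (_, P) (trans (sym PD′≡D) (*-identityʳ P))))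
...   | there (here refl) = there (there (here (cong (_, 𝟙) (sym PD′≡D))))
∈-factorisationsOfSquare {P} {D} {C} P-irr DC≡P² | inj₂ (C′ , PC′≡C)
  with ∈-factorisationsOfIrreducible {P} {D} {C′} P-irr (*-cancelˡ (irreducible⇒≢𝟘 P-irr) (begin
      P * (D * C′)   ≡⟨ regroup P D C′ ⟩
      D * (P * C′)   ≡⟨ cong (D *_) PC′≡C ⟩
      D * C          ≡⟨ DC≡P² ⟩
      P * P          ∎))
  where
  regroup : ∀ P D C′ → P * (D * C′) ≡ D * (P * C′)
  regroup = solve-∀ ring
...   | here refl         = here (cong (𝟙 ,_) (sym PC′≡C))
...   | there (here refl) = there (here (cong (P ,_) (trans (sym PC′≡C) (*-identityʳ P))))

factorisationsOfIrreducible-unique : ∀ {P} → Irreducible P → Unique (factorisationsOfIrreducible P)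
factorisationsOfIrreducible-unique P-irr =
  ((λ eq → irreducible⇒≢𝟙 P-irr (sym (cong proj₁ eq))) All.∷ All.[]) ∷ All.[] ∷ []

factorisationsOfIrreducible-sound : ∀ P → All (λ DC → proj₁ DC * proj₂ DC ≡ P) (factorisationsOfIrreducible P)
factorisationsOfIrreducible-sound P = *-identityˡ P All.∷ *-identityʳ P All.∷ All.[]

factorisationsOfSquare-unique : ∀ {P} → Irreducible P → Unique (factorisationsOfSquare P)
factorisationsOfSquare-unique P-irr =
  ((λ eq → irreducible⇒≢𝟙 P-irr (sym (cong proj₁ eq))) All.∷ (λ eq → square-≢𝟙 P-irr (sym (cong proj₁ eq))) All.∷ All.[])
  ∷ ((λ eq → irreducible-≢-square P-irr (cong proj₁ eq)) All.∷ All.[]) ∷ All.[] ∷ []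

factorisationsOfSquare-sound : ∀ P → All (λ DC → proj₁ DC * proj₂ DC ≡ P * P) (factorisationsOfSquare P)
factorisationsOfSquare-sound P = *-identityˡ (P * P) All.∷ refl All.∷ *-identityʳ (P * P) All.∷ All.[]

squareFree-∣ : ∀ {S D} → SquareFree S → D ∣ S → SquareFree D
squareFree-∣ {S} {D} (S≢𝟘 , noSquare) D∣S =
  ∣⇒≢𝟘 {D} S≢𝟘 D∣S , λ P P-irr P²∣D → noSquare P P-irr (∣-trans {P * P} {D} P²∣D D∣S)

squareFree-*ʳ : ∀ {P Q} → SquareFree (P * Q) → SquareFree Q
squareFree-*ʳ {P} {Q} sf = squareFree-∣ sf (B∣A*B P Q)

squareFree-*⇒∤ : ∀ {P Q} → Irreducible P → SquareFree (P * Q) → ¬ P ∣ Q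
squareFree-*⇒∤ {P} {Q} P-irr (_ , noSquare) (R , PR≡Q) =
  noSquare P P-irr (R , trans (*-assoc P P R) (cong (P *_) PR≡Q))

irreducible∣square⇒∣ : ∀ {P S} → Irreducible P → P ∣ S * S → P ∣ S
irreducible∣square⇒∣ P-irr P∣S² with euclidsLemma P-irr P∣S²
... | inj₁ P∣S = P∣S
... | inj₂ P∣S = P∣S

squareFree∣square⇒∣ : ∀ {X S} → SquareFree X → X ∣ S * S → X ∣ S
squareFree∣square⇒∣ {X} sfX = factor-induction (λ X → ∀ {S} → SquareFree X → X ∣ S * S → X ∣ S)
  (λ {S} _ _ → 𝟙∣ S) step (proj₁ sfX) sfX
  where
  cancel-P : ∀ {P Q Y S S₁} → P ≢ 𝟘 → P * Q * Y ≡ S * S → P * S₁ ≡ S → Q * Y ≡ P * (S₁ * S₁)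
  cancel-P {P} {Q} {Y} {S} {S₁} P≢𝟘 PQY≡S² PS₁≡S = *-cancelˡ P≢𝟘 (begin
    P * (Q * Y)           ≡⟨ *-assoc P Q Y ⟨
    P * Q * Y             ≡⟨ PQY≡S² ⟩
    S * S                 ≡⟨ cong₂ _*_ PS₁≡S PS₁≡S ⟨
    P * S₁ * (P * S₁)     ≡⟨ regroup P S₁ ⟩
    P * (P * (S₁ * S₁))   ∎)
    where
    regroup : ∀ P S₁ → P * S₁ * (P * S₁) ≡ P * (P * (S₁ * S₁))
    regroup = solve-∀ ring
  cancel-P′ : ∀ {P Q Y S₁ Y₁} → P ≢ 𝟘 → Q * Y ≡ P * (S₁ * S₁) → P * Y₁ ≡ Y → Q * Y₁ ≡ S₁ * S₁
  cancel-P′ {P} {Q} {Y} {S₁} {Y₁} P≢𝟘 QY≡PS₁² PY₁≡Y = *-cancelˡ P≢𝟘 (begin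
    P * (Q * Y₁)          ≡⟨ regroup P Q Y₁ ⟩
    Q * (P * Y₁)          ≡⟨ cong (Q *_) PY₁≡Y ⟩
    Q * Y                 ≡⟨ QY≡PS₁² ⟩
    P * (S₁ * S₁)         ∎)
    where
    regroup : ∀ P Q Y₁ → P * (Q * Y₁) ≡ Q * (P * Y₁)
    regroup = solve-∀ ring
  step : ∀ {P Q} → Irreducible P → Q ≢ 𝟘 → (∀ {S} → SquareFree Q → Q ∣ S * S → Q ∣ S) →
         ∀ {S} → SquareFree (P * Q) → P * Q ∣ S * S → P * Q ∣ S
  step {P} {Q} P-irr _ ih {S} sfPQ (Y , PQY≡S²)
    with irreducible∣square⇒∣ P-irr (Q * Y , trans (sym (*-assoc P Q Y)) PQY≡S²)
  ... | S₁ , PS₁≡S with cancel-P {P} {Q} (irreducible⇒≢𝟘 P-irr) PQY≡S² PS₁≡S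
  ...   | QY≡PS₁² with euclidsLemma {P} {Q} {Y} P-irr (S₁ * S₁ , sym QY≡PS₁²)
  ...     | inj₁ P∣Q = ⊥-elim (squareFree-*⇒∤ P-irr sfPQ P∣Q)
  ...     | inj₂ (Y₁ , PY₁≡Y) with ih (squareFree-*ʳ {P} sfPQ) (Y₁ , cancel-P′ {P} {Q} {Y} {S₁} (irreducible⇒≢𝟘 P-irr) QY≡PS₁² PY₁≡Y)
  ...       | Z , QZ≡S₁ = Z , trans (*-assoc P Q Z) (trans (cong (P *_) QZ≡S₁) PS₁≡S)

squareFree-cofactors-of-square : ∀ {D C S} → SquareFree D → SquareFree C → D * C ≡ S * S → D ≡ S
squareFree-cofactors-of-square {D} {C} {S} sfD sfC DC≡S²
  with squareFree∣square⇒∣ {D} {S} sfD (C , DC≡S²) | squareFree∣square⇒∣ {C} {S} sfC (D , trans (*-comm C D) DC≡S²)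
... | D′ , DD′≡S | C′ , CC′≡S = begin
  D        ≡⟨ *-identityʳ D ⟨
  D * 𝟙    ≡⟨ cong (D *_) D′≡𝟙 ⟨
  D * D′   ≡⟨ DD′≡S ⟩
  S        ∎
  where
  regroup : ∀ D C D′ C′ → D * D′ * (C * C′) ≡ D * C * (D′ * C′)
  regroup = solve-∀ ring
  D′≡𝟙 : D′ ≡ 𝟙
  D′≡𝟙 = *≡𝟙⇒≡𝟙 {D′} {C′} (sym (*-cancelˡ (*-≢𝟘 (proj₁ sfD) (proj₁ sfC)) (begin
    D * C * 𝟙             ≡⟨ *-identityʳ (D * C) ⟩
    D * C                 ≡⟨ DC≡S² ⟩
    S * S                 ≡⟨ cong₂ _*_ DD′≡S CC′≡S ⟨
    D * D′ * (C * C′)     ≡⟨ regroup D C D′ C′ ⟩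
    D * C * (D′ * C′)     ∎)))

irreducible-∤⇒coprime : ∀ {P Q} → Irreducible P → ¬ P ∣ Q → Coprime P Q
irreducible-∤⇒coprime {P} P-irr P∤Q E E∣P E∣Q with irreducible-divisor {P} {E} P-irr E∣P
... | inj₁ E≡𝟙 = E≡𝟙
... | inj₂ refl = ⊥-elim (P∤Q E∣Q)

square-∤⇒coprime : ∀ {P Q} → Irreducible P → ¬ P ∣ Q → Coprime (P * P) Q
square-∤⇒coprime {P} P-irr P∤Q E (C , EC≡P²) E∣Q with ∈-factorisationsOfSquare {P} {E} {C} P-irr EC≡P²
... | here refl                 = refl
... | there (here refl)         = ⊥-elim (P∤Q E∣Q)
... | there (there (here refl)) = ⊥-elim (P∤Q (∣-trans {P} {P * P} (A∣A*B P P) E∣Q))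

squareFree⇒cube∤square : ∀ {S P} → SquareFree S → Irreducible P → ¬ P * P * P ∣ S * S
squareFree⇒cube∤square {S} {P} (_ , noSquare) P-irr (X , P³X≡S²) =
  root-contradiction (irreducible∣square⇒∣ {P} {S} P-irr (P * P * X , trans (regroup₁ P X) P³X≡S²))
  where
  regroup₁ : ∀ P X → P * (P * P * X) ≡ P * P * P * X
  regroup₁ = solve-∀ ring
  regroup₂ : ∀ P X → P * P * (P * X) ≡ P * P * P * X
  regroup₂ = solve-∀ ring
  regroup₃ : ∀ P S₁ → P * S₁ * (P * S₁) ≡ P * P * (S₁ * S₁)
  regroup₃ = solve-∀ ring
  P≢𝟘 : P ≢ 𝟘
  P≢𝟘 = irreducible⇒≢𝟘 P-irr
  root-contradiction : P ∣ S → ⊥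
  root-contradiction (S₁ , PS₁≡S) = noSquare P P-irr (P²∣PS₁ (irreducible∣square⇒∣ {P} {S₁} P-irr (X , PX≡S₁²)))
    where
    PX≡S₁² : P * X ≡ S₁ * S₁
    PX≡S₁² = *-cancelˡ (*-≢𝟘 P≢𝟘 P≢𝟘) (begin
      P * P * (P * X)     ≡⟨ regroup₂ P X ⟩
      P * P * P * X       ≡⟨ P³X≡S² ⟩
      S * S               ≡⟨ cong₂ _*_ PS₁≡S PS₁≡S ⟨
      P * S₁ * (P * S₁)   ≡⟨ regroup₃ P S₁ ⟩
      P * P * (S₁ * S₁)   ∎)
    P²∣PS₁ : P ∣ S₁ → P * P ∣ S
    P²∣PS₁ (Z , PZ≡S₁) = Z , trans (*-assoc P P Z) (trans (cong (P *_) PZ≡S₁) PS₁≡S)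

unique-map⁺ : ∀ {X Y : Set} (f : X → Y) {xs} → Unique xs →
              (∀ {x y} → x ∈ xs → y ∈ xs → f x ≡ f y → x ≡ y) → Unique (map f xs)
unique-map⁺ f {[]}     []           _         = []
unique-map⁺ f {x ∷ xs} (x∉xs ∷ xs!) injective =
  All.tabulate fx∉ ∷ unique-map⁺ f xs! (λ x∈ y∈ → injective (there x∈) (there y∈))
  where
  fx∉ : ∀ {z} → z ∈ map f xs → f x ≢ z
  fx∉ z∈ fx≡z with ∈-map⁻ f z∈
  ... | y , y∈ , refl = All.lookup x∉xs y∈ (injective (here refl) (there y∈) fx≡z)

divisors-unique : ∀ {A} → A ≢ 𝟘 → Unique (divisors A)
divisors-unique {A} A≢𝟘 = unique-map⁺ proj₁ (divPairs-unique A) injective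
  where
  injective : ∀ {x y} → x ∈ divPairs A → y ∈ divPairs A → proj₁ x ≡ proj₁ y → x ≡ y
  injective {D , C} {.D , C′} DC∈ DC′∈ refl = cong (D ,_)
    (*-cancelˡ (factorˡ-≢𝟘 {D} {C} A≢𝟘 (divPairs-sound {A} DC∈))
               (trans (divPairs-sound {A} DC∈) (sym (divPairs-sound {A} DC′∈))))

-- Every divisor of P · Q with P ∤ Q is either a divisor of Q or P times one.
σ-* : ∀ {P Q} → Irreducible P → Q ≢ 𝟘 → ¬ P ∣ Q → σ (P * Q) ≡ (𝟙 + P) * σ Q
σ-* {P} {Q} P-irr Q≢𝟘 P∤Q = begin
  σ (P * Q)                                        ≡⟨ sumP-↭ (unique-sameElements⇒↭ (divisors-unique PQ≢𝟘) split! ⊆split split⊆) ⟩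
  sumP (divisors Q ++ map (P *_) (divisors Q))     ≡⟨ sumP-++ (divisors Q) (map (P *_) (divisors Q)) ⟩
  σ Q + sumP (map (P *_) (divisors Q))             ≡⟨ cong (σ Q +_) (sumP-map-*ˡ P (divisors Q)) ⟩
  σ Q + P * σ Q                                    ≡⟨ cong (_+ P * σ Q) (*-identityˡ (σ Q)) ⟨
  𝟙 * σ Q + P * σ Q                                ≡⟨ *-distribʳ-+ 𝟙 P (σ Q) ⟨
  (𝟙 + P) * σ Q                                    ∎
  where
  P≢𝟘 : P ≢ 𝟘
  P≢𝟘 = irreducible⇒≢𝟘 P-irr
  PQ≢𝟘 : P * Q ≢ 𝟘
  PQ≢𝟘 = *-≢𝟘 P≢𝟘 Q≢𝟘
  split! : Unique (divisors Q ++ map (P *_) (divisors Q))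
  split! = Unique.++⁺ (divisors-unique Q≢𝟘) (Unique.map⁺ (*-cancelˡ P≢𝟘) (divisors-unique Q≢𝟘)) disjoint
    where
    disjoint : ∀ {E} → ¬ (E ∈ divisors Q × E ∈ map (P *_) (divisors Q))
    disjoint (E∈ , E∈P*) with ∈-map⁻ (P *_) E∈P*
    ... | E′ , _ , refl = P∤Q (∣-trans {P} {P * E′} (A∣A*B P E′) (∈-divisors⁻ {Q} E∈))
  ⊆split : ∀ {E} → E ∈ divisors (P * Q) → E ∈ divisors Q ++ map (P *_) (divisors Q)
  ⊆split {E} E∈ with ∈-divisors⁻ {P * Q} {E} E∈
  ... | C , EC≡PQ with euclidsLemma {P} {E} {C} P-irr (Q , sym EC≡PQ)
  ...   | inj₁ (E′ , PE′≡E) = ∈-++⁺ʳ (divisors Q) (subst (_∈ map (P *_) (divisors Q)) PE′≡E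
          (∈-map⁺ (P *_) (∈-divisors⁺ Q≢𝟘 (C , *-cancelˡ P≢𝟘 (trans (sym (*-assoc P E′ C)) (trans (cong (_* C) PE′≡E) EC≡PQ))))))
  ...   | inj₂ (C′ , PC′≡C) = ∈-++⁺ˡ (∈-divisors⁺ Q≢𝟘 (C′ , *-cancelˡ P≢𝟘 (trans (regroup P E C′) (trans (cong (E *_) PC′≡C) EC≡PQ))))
    where
    regroup : ∀ P E C′ → P * (E * C′) ≡ E * (P * C′)
    regroup = solve-∀ ring
  split⊆ : ∀ {E} → E ∈ divisors Q ++ map (P *_) (divisors Q) → E ∈ divisors (P * Q)
  split⊆ {E} E∈ with ∈-++⁻ (divisors Q) E∈
  ... | inj₁ E∈Q = ∈-divisors⁺ PQ≢𝟘 (∣-trans {E} {Q} (∈-divisors⁻ {Q} E∈Q) (B∣A*B P Q))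
  ... | inj₂ E∈P* with ∈-map⁻ (P *_) E∈P*
  ...   | E′ , E′∈ , refl with ∈-divisors⁻ {Q} {E′} E′∈
  ...     | C , E′C≡Q = ∈-divisors⁺ PQ≢𝟘 (C , trans (*-assoc P E′ C) (cong (P *_) E′C≡Q))

prodP-irreducibleFactors : ∀ L {S} → SquareFree S → Unique L →
                           (∀ {P} → P ∈ L → Irreducible P × P ∣ S) → (∀ {P} → Irreducible P → P ∣ S → P ∈ L) →
                           prodP L ≡ S
prodP-irreducibleFactors [] {S} (S≢𝟘 , _) _ _ complete with S ≟ 𝟙
... | yes S≡𝟙 = sym S≡𝟙
... | no  S≢𝟙 with irreducible-factor (≢𝟘∧≢𝟙⇒nonConstant S≢𝟘 S≢𝟙)
...   | P , P-irr , P∣S with complete P-irr P∣S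
...     | ()
prodP-irreducibleFactors (P ∷ L) {S} sfS (P∉L ∷ L!) sound complete with sound (here refl)
... | P-irr , S′ , PS′≡S = trans (cong (P *_) (prodP-irreducibleFactors L sfS′ L! sound′ complete′)) PS′≡S
  where
  sfS′ : SquareFree S′
  sfS′ = squareFree-*ʳ {P} (subst SquareFree (sym PS′≡S) sfS)
  P∤S′ : ¬ P ∣ S′
  P∤S′ = squareFree-*⇒∤ P-irr (subst SquareFree (sym PS′≡S) sfS)
  sound′ : ∀ {Q} → Q ∈ L → Irreducible Q × Q ∣ S′
  sound′ {Q} Q∈ with sound (there Q∈)
  ... | Q-irr , Q∣S with euclidsLemma {Q} {P} {S′} Q-irr (subst (Q ∣_) (sym PS′≡S) Q∣S)
  ...   | inj₂ Q∣S′ = Q-irr , Q∣S′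
  ...   | inj₁ Q∣P with irreducible-divisor {P} {Q} P-irr Q∣P
  ...     | inj₁ Q≡𝟙 = ⊥-elim (irreducible⇒≢𝟙 Q-irr Q≡𝟙)
  ...     | inj₂ refl = ⊥-elim (All.lookup P∉L Q∈ refl)
  complete′ : ∀ {Q} → Irreducible Q → Q ∣ S′ → Q ∈ L
  complete′ {Q} Q-irr Q∣S′ with complete Q-irr (∣-trans {Q} {S′} Q∣S′ (P , trans (*-comm S′ P) PS′≡S))
  ... | here refl = ⊥-elim (P∤S′ Q∣S′)
  ... | there Q∈L = Q∈L

rad-square : ∀ {S} → SquareFree S → rad (S * S) ≡ S
rad-square {S} sfS = prodP-irreducibleFactors (filterᵇ irreducible? (divisors (S * S))) sfS
  (Unique.filter⁺ (T? ∘ irreducible?) (divisors-unique S²≢𝟘)) sound complete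
  where
  S²≢𝟘 : S * S ≢ 𝟘
  S²≢𝟘 = *-≢𝟘 (proj₁ sfS) (proj₁ sfS)
  sound : ∀ {P} → P ∈ filterᵇ irreducible? (divisors (S * S)) → Irreducible P × P ∣ S
  sound {P} P∈ with ∈-filter⁻ (T? ∘ irreducible?) {xs = divisors (S * S)} P∈
  ... | P∈divisors , irreducible = P-irr , irreducible∣square⇒∣ P-irr (∈-divisors⁻ {S * S} P∈divisors)
    where
    P-irr : Irreducible P
    P-irr = irreducible?-sound irreducible
  complete : ∀ {P} → Irreducible P → P ∣ S → P ∈ filterᵇ irreducible? (divisors (S * S))
  complete {P} P-irr P∣S = ∈-filter⁺ (T? ∘ irreducible?)
    (∈-divisors⁺ S²≢𝟘 (∣-trans {P} {S} P∣S (A∣A*B S S))) (irreducible?-complete P-irr)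

-- Unitary divisors and the Dirichlet inverse of σ*

unitary? : Poly × Poly → Bool
unitary? DC = coprime? (proj₁ DC) (proj₂ DC)

σ*-irreducible : ∀ {P} → Irreducible P → σ* P ≡ 𝟙 + P
σ*-irreducible {P} P-irr = begin
  σ* P                                              ≡⟨ sumP-map-filter-divPairs unitary? proj₁ P≢𝟘
                                                         (factorisationsOfIrreducible-unique P-irr) complete sound ⟩
  sumP (map proj₁ (factorisationsOfIrreducible P))  ≡⟨ cong (𝟙 +_) (+-identityʳ P) ⟩
  𝟙 + P                                             ∎
  where
  P≢𝟘 : P ≢ 𝟘
  P≢𝟘 = irreducible⇒≢𝟘 P-irr
  complete : ∀ {D C} → D * C ≡ P → T (unitary? (D , C)) → (D , C) ∈ factorisationsOfIrreducible P
  complete DC≡P _ = ∈-factorisationsOfIrreducible P-irr DC≡P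
  sound : All (λ DC → proj₁ DC * proj₂ DC ≡ P × T (unitary? DC)) (factorisationsOfIrreducible P)
  sound = (*-identityˡ P , coprime?-complete (coprime-𝟙ˡ P))
    All.∷ (*-identityʳ P , coprime?-complete (coprime-𝟙ʳ P)) All.∷ All.[]

-- gcd(P, P) ≠ 1, so the factorisation P · P is not unitary and drops out of σ*(P²).
σ*-square : ∀ {P} → Irreducible P → σ* (P * P) ≡ 𝟙 + P * P
σ*-square {P} P-irr = begin
  σ* (P * P)                                         ≡⟨ sumP-map-filter-divPairs unitary? proj₁ P²≢𝟘 unique complete sound ⟩
  sumP (map proj₁ ((𝟙 , P * P) ∷ (P * P , 𝟙) ∷ []))  ≡⟨ cong (𝟙 +_) (+-identityʳ (P * P)) ⟩
  𝟙 + P * P                                          ∎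
  where
  P≢𝟘 : P ≢ 𝟘
  P≢𝟘 = irreducible⇒≢𝟘 P-irr
  P²≢𝟘 : P * P ≢ 𝟘
  P²≢𝟘 = *-≢𝟘 P≢𝟘 P≢𝟘
  unique : Unique ((𝟙 , P * P) ∷ (P * P , 𝟙) ∷ [])
  unique = ((λ eq → square-≢𝟙 P-irr (sym (cong proj₁ eq))) All.∷ All.[]) ∷ All.[] ∷ []
  complete : ∀ {D C} → D * C ≡ P * P → T (unitary? (D , C)) → (D , C) ∈ (𝟙 , P * P) ∷ (P * P , 𝟙) ∷ []
  complete {D} {C} DC≡P² unitary with ∈-factorisationsOfSquare {P} {D} {C} P-irr DC≡P²
  ... | here refl                 = here refl
  ... | there (here refl)         = ⊥-elim (irreducible⇒≢𝟙 P-irr (coprime?-sound P≢𝟘 P≢𝟘 unitary P (∣-refl P) (∣-refl P)))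
  ... | there (there (here refl)) = there (here refl)
  sound : All (λ DC → proj₁ DC * proj₂ DC ≡ P * P × T (unitary? DC)) ((𝟙 , P * P) ∷ (P * P , 𝟙) ∷ [])
  sound = (*-identityˡ (P * P) , coprime?-complete (coprime-𝟙ˡ (P * P)))
    All.∷ (*-identityʳ (P * P) , coprime?-complete (coprime-𝟙ʳ (P * P))) All.∷ All.[]

δ-≢𝟙 : ∀ {A} → A ≢ 𝟙 → δ A ≡ 𝟘
δ-≢𝟙 {A} A≢𝟙 with A ≟ 𝟙
... | yes A≡𝟙 = ⊥-elim (A≢𝟙 A≡𝟙)
... | no  _   = refl

module SigmaStarInverse {g : Poly → Poly} (g-inv : IsSigmaStarInv g) where

  g-multiplicative : Multiplicative g
  g-multiplicative = proj₁ g-inv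

  σ*⋆g≡δ : ∀ A → A ≢ 𝟘 → (σ* ⋆ g) A ≡ δ A
  σ*⋆g≡δ = proj₂ g-inv

  convolution-term : Poly × Poly → Poly
  convolution-term DC = σ* (proj₁ DC) * g (proj₂ DC)

  -- σ* 𝟙 and hence (σ* ⋆ g) 𝟙 = 𝟙 * g 𝟙 + 𝟘 are computed by evaluation.
  g𝟙≡𝟙 : g 𝟙 ≡ 𝟙
  g𝟙≡𝟙 = trans (sym (trans (+-identityʳ (𝟙 * g 𝟙)) (*-identityˡ (g 𝟙)))) (σ*⋆g≡δ 𝟙 (λ ()))

  g-irreducible : ∀ {P} → Irreducible P → g P ≡ 𝟙 + P
  g-irreducible {P} P-irr = trans (+≡𝟘⇒≡ (g P) (σ* P) g+σ*≡𝟘) (σ*-irreducible P-irr)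
    where
    P≢𝟘 : P ≢ 𝟘
    P≢𝟘 = irreducible⇒≢𝟘 P-irr
    g+σ*≡𝟘 : g P + σ* P ≡ 𝟘
    g+σ*≡𝟘 = begin
      g P + σ* P
        ≡⟨ cong₂ _+_ (*-identityˡ (g P)) (trans (cong (σ* P *_) g𝟙≡𝟙) (*-identityʳ (σ* P))) ⟨
      𝟙 * g P + σ* P * g 𝟙
        ≡⟨ cong (𝟙 * g P +_) (+-identityʳ (σ* P * g 𝟙)) ⟨
      sumP (map convolution-term (factorisationsOfIrreducible P))
        ≡⟨ sumP-map-divPairs convolution-term P≢𝟘 (factorisationsOfIrreducible-unique P-irr)
             (∈-factorisationsOfIrreducible P-irr) (factorisationsOfIrreducible-sound P) ⟨
      (σ* ⋆ g) P
        ≡⟨ σ*⋆g≡δ P P≢𝟘 ⟩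
      δ P
        ≡⟨ δ-≢𝟙 (irreducible⇒≢𝟙 P-irr) ⟩
      𝟘
        ∎

  g-square : ∀ {P} → Irreducible P → g (P * P) ≡ 𝟘
  g-square {P} P-irr = +≡𝟘⇒≡ (g (P * P)) 𝟘 (begin
    g (P * P) + 𝟘
      ≡⟨ cong₂ _+_ (*-identityˡ (g (P * P))) rest≡𝟘 ⟨
    𝟙 * g (P * P) + (σ* P * g P + (σ* (P * P) * g 𝟙 + 𝟘))
      ≡⟨ sumP-map-divPairs convolution-term P²≢𝟘 (factorisationsOfSquare-unique P-irr)
           (∈-factorisationsOfSquare P-irr) (factorisationsOfSquare-sound P) ⟨
    (σ* ⋆ g) (P * P)
      ≡⟨ σ*⋆g≡δ (P * P) P²≢𝟘 ⟩
    δ (P * P)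
      ≡⟨ δ-≢𝟙 (square-≢𝟙 P-irr) ⟩
    𝟘
      ∎)
    where
    P≢𝟘 : P ≢ 𝟘
    P≢𝟘 = irreducible⇒≢𝟘 P-irr
    P²≢𝟘 : P * P ≢ 𝟘
    P²≢𝟘 = *-≢𝟘 P≢𝟘 P≢𝟘
    rest≡𝟘 : σ* P * g P + (σ* (P * P) * g 𝟙 + 𝟘) ≡ 𝟘
    rest≡𝟘 = begin
      σ* P * g P + (σ* (P * P) * g 𝟙 + 𝟘)
        ≡⟨ cong₂ (λ U V → U + (V + 𝟘)) (cong₂ _*_ (σ*-irreducible P-irr) (g-irreducible P-irr))
                                        (cong₂ _*_ (σ*-square P-irr) g𝟙≡𝟙) ⟩
      (𝟙 + P) * (𝟙 + P) + ((𝟙 + P * P) * 𝟙 + 𝟘)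
        ≡⟨ cong₂ _+_ (frobenius 𝟙 P) (trans (+-identityʳ _) (*-identityʳ (𝟙 + P * P))) ⟩
      (𝟙 + P * P) + (𝟙 + P * P)
        ≡⟨ +-self (𝟙 + P * P) ⟩
      𝟘
        ∎

  σ≡g-squareFree : ∀ {S} → SquareFree S → σ S ≡ g S
  σ≡g-squareFree sfS = factor-induction (λ S → SquareFree S → σ S ≡ g S) (λ _ → sym g𝟙≡𝟙) step (proj₁ sfS) sfS
    where
    step : ∀ {P Q} → Irreducible P → Q ≢ 𝟘 → (SquareFree Q → σ Q ≡ g Q) → SquareFree (P * Q) → σ (P * Q) ≡ g (P * Q)
    step {P} {Q} P-irr Q≢𝟘 ih sfPQ = begin
      σ (P * Q)          ≡⟨ σ-* P-irr Q≢𝟘 P∤Q ⟩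
      (𝟙 + P) * σ Q      ≡⟨ cong₂ _*_ (sym (g-irreducible P-irr)) (ih (squareFree-*ʳ {P} sfPQ)) ⟩
      g P * g Q          ≡⟨ g-multiplicative P Q (irreducible⇒≢𝟘 P-irr) Q≢𝟘 (irreducible-∤⇒coprime P-irr P∤Q) ⟨
      g (P * Q)          ∎
      where
      P∤Q : ¬ P ∣ Q
      P∤Q = squareFree-*⇒∤ P-irr sfPQ

  g-squareFactor≡𝟘 : ∀ {S D P} → SquareFree S → D ∣ S * S → Irreducible P → P * P ∣ D → g D ≡ 𝟘
  g-squareFactor≡𝟘 {S} {D} {P} sfS D∣S² P-irr (D′ , P²D′≡D) = begin
    g D                 ≡⟨ cong g P²D′≡D ⟨
    g (P * P * D′)      ≡⟨ g-multiplicative (P * P) D′ P²≢𝟘 D′≢𝟘 (square-∤⇒coprime P-irr P∤D′) ⟩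
    g (P * P) * g D′    ≡⟨ cong (_* g D′) (g-square P-irr) ⟩
    𝟘                   ∎
    where
    P≢𝟘 : P ≢ 𝟘
    P≢𝟘 = irreducible⇒≢𝟘 P-irr
    P²≢𝟘 : P * P ≢ 𝟘
    P²≢𝟘 = *-≢𝟘 P≢𝟘 P≢𝟘
    D′≢𝟘 : D′ ≢ 𝟘
    D′≢𝟘 = factorʳ-≢𝟘 {P * P} (∣⇒≢𝟘 {D} (*-≢𝟘 (proj₁ sfS) (proj₁ sfS)) D∣S²) P²D′≡D
    P∤D′ : ¬ P ∣ D′
    P∤D′ (X , PX≡D′) = squareFree⇒cube∤square sfS P-irr
      (∣-trans {P * P * P} {D} (X , trans (*-assoc (P * P) P X) (trans (cong (P * P *_) PX≡D′) P²D′≡D)) D∣S²)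

  restrictedSum-square : ∀ {S} → SquareFree S → S ≢ 𝟙 → restrictedSum g (S * S) ≡ g S
  restrictedSum-square {S} sfS S≢𝟙 =
    sumP-map-single (λ DC → g (proj₁ DC)) (filterᵇ admissible? (divPairs (S * S)))
      (Unique.filter⁺ (T? ∘ admissible?) (divPairs-unique (S * S))) SS∈ others≡𝟘
    where
    admissible? : Poly × Poly → Bool
    admissible? DC = not (proj₁ DC == (S * S)) ∧ not (proj₁ DC == 𝟙) ∧ squareFree? (proj₂ DC)
    S≢𝟘 : S ≢ 𝟘
    S≢𝟘 = proj₁ sfS
    S²≢𝟘 : S * S ≢ 𝟘
    S²≢𝟘 = *-≢𝟘 S≢𝟘 S≢𝟘
    S≢S² : S ≢ S * S
    S≢S² S≡S² = S≢𝟙 (sym (*-cancelˡ S≢𝟘 (trans (*-identityʳ S) S≡S²)))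
    SS∈ : (S , S) ∈ filterᵇ admissible? (divPairs (S * S))
    SS∈ = ∈-filter-divPairs⁺ admissible? S²≢𝟘 refl
      (Equivalence.from (T-∧ {not (S == (S * S))}) (≢⇒not== S≢S² ,
        Equivalence.from (T-∧ {not (S == 𝟙)}) (≢⇒not== S≢𝟙 , squareFree?-complete sfS)))
    others≡𝟘 : ∀ {DC} → DC ∈ filterᵇ admissible? (divPairs (S * S)) → DC ≢ (S , S) → g (proj₁ DC) ≡ 𝟘
    others≡𝟘 {D , C} DC∈ DC≢SS with ∈-filter-divPairs⁻ admissible? {D , C} DC∈
    ... | DC≡S² , admissible with T? (squareFree? D)
    ...   | no  D-notSquareFree =
      let P , P-irr , P²∣D = ¬squareFree?⇒squareFactor D-notSquareFree
      in g-squareFactor≡𝟘 sfS (C , DC≡S²) P-irr P²∣D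
    ...   | yes D-squareFree = ⊥-elim (DC≢SS (cong₂ _,_ D≡S C≡S))
      where
      C-squareFree : T (squareFree? C)
      C-squareFree = proj₂ (Equivalence.to (T-∧ {not (D == 𝟙)}) (proj₂ (Equivalence.to (T-∧ {not (D == (S * S))}) admissible)))
      sfD : SquareFree D
      sfD = squareFree?-sound (factorˡ-≢𝟘 {D} {C} S²≢𝟘 DC≡S²) D-squareFree
      sfC : SquareFree C
      sfC = squareFree?-sound (factorʳ-≢𝟘 {D} {C} S²≢𝟘 DC≡S²) C-squareFree
      D≡S : D ≡ S
      D≡S = squareFree-cofactors-of-square sfD sfC DC≡S²
      C≡S : C ≡ S
      C≡S = *-cancelˡ S≢𝟘 (trans (cong (_* C) (sym D≡S)) DC≡S²)

open SigmaStarInverse using (σ≡g-squareFree; restrictedSum-square)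

corollary4p24 : (g : Poly → Poly) → IsSigmaStarInv g →
                (A : Poly) → NonConstant A → Special A → Perfect A →
                restrictedSum g A ≡ σ (rad A)
corollary4p24 g g-inv .(S * S) A-nonConstant (S , sfS , refl) _ = begin
  restrictedSum g (S * S)   ≡⟨ restrictedSum-square g-inv sfS S≢𝟙 ⟩
  g S                       ≡⟨ σ≡g-squareFree g-inv sfS ⟨
  σ S                       ≡⟨ cong σ (rad-square sfS) ⟨
  σ (rad (S * S))           ∎
  where
  S≢𝟙 : S ≢ 𝟙
  S≢𝟙 refl = A-nonConstant
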